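{- For all $P,Q\in\mathsf{nCSP}$, if $P\sqsubseteq_SQ$ then $P\sqsubseteq_{E_{\mathrm{may}}}Q$.
   Context: Processes. Let $\mathsf{Act}$ be a finite set of visible actions, $\tau\notin\mathsf{Act}$. $\mathsf{nCSP}$ terms: $P::=S\mid P\oplus_pP$ ($0<p<1$), $S::=\mathbf 0\mid a.P\ (a\in\mathsf{Act})\mid P\sqcap P\mid S\Box S$ (sort $S$: state-based terms, set $\mathsf{sCSP}$); $P\Box Q$ for non-state-based $P,Q$ abbreviates distributing $\Box$ over $\oplus_p$. Distributions: finitely supported probability functions on state-based terms; $\overline x$ point distribution. $[\![s]\!]=\overline s$, $[\![P\oplus_pQ]\!]=p[\![P]\!]+(1-p)[\![Q]\!]$. Transitions: $a.P\xrightarrow{a}[\![P]\!]$; $P\sqcap Q\xrightarrow{\tau}[\![P]\!],[\![Q]\!]$; visible moves of $s_1$ (resp. $s_2$) are moves of $s_1\Box s_2$; $s_1\xrightarrow{\tau}\Delta$ gives $s_1\Box s_2\xrightarrow{\tau}\Delta\Box s_2$ and $s_2\Box s_1\xrightarrow{\tau}s_2\Box\Delta$. Simulation: lifting $\Delta\overline{\mathcal R}\Theta$ iff $\Delta=\sum_ip_i\overline{s_i}$, $s_i\mathcal R\Phi_i$, $\Theta=\sum_ip_i\Phi_i$ (finite, weights sum 1, $s_i$ not necessarily distinct); transitions lifted likewise; $s\xrightarrow{\hat\tau}\Delta$ iff $s\xrightarrow{\tau}\Delta$ or $\Delta=\overline s$; $\stackrel{\hat\tau}{\Longrightarrow}$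 = reflexive transitive closure of lifted $\xrightarrow{\hat\tau}$; $\stackrel{\hat a}{\Longrightarrow}=\stackrel{\hat\tau}{\Longrightarrow}\xrightarrow{a}\stackrel{\hat\tau}{\Longrightarrow}$. $\mathcal R\subseteq\mathsf{sCSP}\times\mathcal D(\mathsf{sCSP})$ is a simulation if $s\mathcal R\Theta$, $s\xrightarrow{\alpha}\Delta$ imply $\Theta\stackrel{\hat\alpha}{\Longrightarrow}\Theta'$ with $\Delta\overline{\mathcal R}\Theta'$ ($\hat\alpha=\hat\tau$ for $\alpha=\tau$); $\lhd_S$ is the union of all simulations; $P\sqsubseteq_SQ$ iff $[\![Q]\!]\stackrel{\hat\tau}{\Longrightarrow}\Theta$ for some $\Theta$ with $[\![P]\!]\overline{\lhd_S}\Theta$. Axioms. Equations: (P1) $P\oplus_pP=P$; (P2) $P\oplus_pQ=Q\oplus_{1-p}P$; (P3) $(P\oplus_pQ)\oplus_qR=P\oplus_{p\cdot q}(Q\oplus_{\frac{(1-p)q}{1-pq}}R)$; (I1)–(I3) idempotence, commutativity, associativity of $\sqcap$; (E1) $P\Box\mathbf 0=P$, (E2)–(E3) commutativity, associativity of $\Box$; (EI) $a.P\Box a.Q=a.P\sqcap a.Q$; (D1) $P\Box(Q\oplus_pR)=(P\Box Q)\oplus_p(P\Box R)$; (D2) $a.P\Box(Q\sqcap R)=(a.P\Box Q)\sqcap(a.P\Box R)$; (D3) $(P_1\sqcap P_2)\Box(Q_1\sqcap Q_2)=(P_1\Box(Q_1\sqcap Q_2))\sqcap(P_2\Box(Q_1\sqcap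 Q_2))\sqcap((P_1\sqcap P_2)\Box Q_1)\sqcap((P_1\sqcap P_2)\Box Q_2)$. May axioms: (May0) $a.P\Box b.Q=a.P\sqcap b.Q$; (May1) $P\sqsubseteq P\sqcap Q$; (May2) $\mathbf 0\sqsubseteq P$; (May3) $a.(P\oplus_pQ)\sqsubseteq a.P\oplus_pa.Q$. $P\sqsubseteq_{E_{\mathrm{may}}}Q$ means $P\sqsubseteq Q$ is derivable in inequational logic (reflexivity, transitivity, substitution, monotonicity under all operators, equations in both directions) from the equations and the may axioms.
   Formalization: The probabilities p of the operators $\oplus_p$ are rational, and so are all weights of distributions and of the decompositions used in liftings. -}

module Defs where

open import Level using (Level; _⊔_) renaming (suc to lsuc; zero to lzero)
open import Data.Nat using (ℕ)
open import Data.Fin using (Fin)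
import Data.Fin.Properties as FinP
open import Data.Rational using (ℚ; 0ℚ; 1ℚ; _+_; _*_; _-_; _<_; _≤_)
import Data.Rational.Properties as ℚP
open import Data.Product using (Σ; ∃; ∃-syntax; _×_; _,_; proj₁)
open import Data.Sum using (_⊎_)
open import Data.List using (List; []; _∷_; _++_; map; concatMap; foldr)
open import Data.List.Relation.Unary.All using (All)
open import Relation.Binary.PropositionalEquality using (_≡_; refl)
open import Relation.Binary.Construct.Closure.ReflexiveTransitive using (Star)
open import Relation.Nullary using (Dec; yes; no)

-- Probabilities: rationals p with 0 < p < 1 (proofs irrelevant, so two
-- probabilities are equal iff their values are).

record Prob : Set where
  constructor prob
  field
    val  : ℚ
    .pos : 0ℚ < val
    .lt1 : val < 1ℚ
open Prob public

-- Syntax of nCSP over the finite action set Act = Fin n.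
--   Proc n  : the terms P  (nCSP)
--   SProc n : the state-based terms S  (sCSP)

infixr 6 _⊕⟨_⟩_
infixr 7 _⊓ˢ_
infixr 8 _□ˢ_
infixr 9 _·_

mutual
  data Proc (n : ℕ) : Set where
    ⌜_⌝     : SProc n → Proc n
    _⊕⟨_⟩_  : Proc n → Prob → Proc n → Proc n

  data SProc (n : ℕ) : Set where
    nil   : SProc n
    _·_   : Fin n → Proc n → SProc n
    _⊓ˢ_  : Proc n → Proc n → SProc n
    _□ˢ_  : SProc n → SProc n → SProc n

module _ {n : ℕ} where

  infixr 7 _⊓_
  infixr 8 _□_
  infixr 9 _∙_

  𝟎 : Proc n
  𝟎 = ⌜ nil ⌝

  _∙_ : Fin n → Proc n → Proc n
  a ∙ P = ⌜ a · P ⌝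

  _⊓_ : Proc n → Proc n → Proc n
  P ⊓ Q = ⌜ P ⊓ˢ Q ⌝

  _□_ : Proc n → Proc n → Proc n
  ⌜ s ⌝ □ ⌜ t ⌝ = ⌜ s □ˢ t ⌝
  (P ⊕⟨ p ⟩ Q) □ R = (P □ R) ⊕⟨ p ⟩ (Q □ R)
  ⌜ s ⌝ □ (Q ⊕⟨ p ⟩ R) = (⌜ s ⌝ □ Q) ⊕⟨ p ⟩ (⌜ s ⌝ □ R)

  private
    probEq : (p q : Prob) → Dec (p ≡ q)
    probEq (prob v _ _) (prob w _ _) with v ℚP.≟ w
    ... | yes refl = yes refl
    ... | no ne = no λ { refl → ne refl }

  mutual
    _≟P_ : (P Q : Proc n) → Dec (P ≡ Q)
    ⌜ s ⌝ ≟P ⌜ t ⌝ with s ≟S t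
    ... | yes refl = yes refl
    ... | no ne = no λ { refl → ne refl }
    ⌜ s ⌝ ≟P (_ ⊕⟨ _ ⟩ _) = no λ ()
    (_ ⊕⟨ _ ⟩ _) ≟P ⌜ t ⌝ = no λ ()
    (P ⊕⟨ p ⟩ Q) ≟P (P' ⊕⟨ p' ⟩ Q') with P ≟P P' | probEq p p' | Q ≟P Q'
    ... | yes refl | yes refl | yes refl = yes refl
    ... | no ne | _ | _ = no λ { refl → ne refl }
    ... | yes _ | no ne | _ = no λ { refl → ne refl }
    ... | yes _ | yes _ | no ne = no λ { refl → ne refl }

    _≟S_ : (s t : SProc n) → Dec (s ≡ t)
    nil ≟S nil = yes refl
    nil ≟S (_ · _) = no λ ()
    nil ≟S (_ ⊓ˢ _) = no λ ()
    nil ≟S (_ □ˢ _) = no λ ()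
    (_ · _) ≟S nil = no λ ()
    (a · P) ≟S (b · Q) with a FinP.≟ b | P ≟P Q
    ... | yes refl | yes refl = yes refl
    ... | no ne | _ = no λ { refl → ne refl }
    ... | yes _ | no ne = no λ { refl → ne refl }
    (_ · _) ≟S (_ ⊓ˢ _) = no λ ()
    (_ · _) ≟S (_ □ˢ _) = no λ ()
    (_ ⊓ˢ _) ≟S nil = no λ ()
    (_ ⊓ˢ _) ≟S (_ · _) = no λ ()
    (P ⊓ˢ Q) ≟S (P' ⊓ˢ Q') with P ≟P P' | Q ≟P Q'
    ... | yes refl | yes refl = yes refl
    ... | no ne | _ = no λ { refl → ne refl }
    ... | yes _ | no ne = no λ { refl → ne refl }
    (_ ⊓ˢ _) ≟S (_ □ˢ _) = no λ ()
    (_ □ˢ _) ≟S nil = no λ ()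
    (_ □ˢ _) ≟S (_ · _) = no λ ()
    (_ □ˢ _) ≟S (_ ⊓ˢ _) = no λ ()
    (s □ˢ t) ≟S (s' □ˢ t') with s ≟S s' | t ≟S t'
    ... | yes refl | yes refl = yes refl
    ... | no ne | _ = no λ { refl → ne refl }
    ... | yes _ | no ne = no λ { refl → ne refl }

  -- Distributions over sCSP, represented as finite weighted lists;
  -- the probability of s is the total weight of entries equal to s.

  Dist : Set
  Dist = List (ℚ × SProc n)

  mass : SProc n → Dist → ℚ
  mass s [] = 0ℚ
  mass s ((w , t) ∷ Δ) with t ≟S s
  ... | yes _ = w + mass s Δ
  ... | no _  = mass s Δ

  totalWeight : Dist → ℚ
  totalWeight = foldr (λ e r → proj₁ e + r) 0ℚ

  IsDist : Dist → Set
  IsDist Δ = All (λ e → 0ℚ ≤ proj₁ e) Δ × totalWeight Δ ≡ 1ℚ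

  _≈_ : Dist → Dist → Set
  Δ ≈ Θ = ∀ s → mass s Δ ≡ mass s Θ

  point : SProc n → Dist
  point s = (1ℚ , s) ∷ []

  scale : ℚ → Dist → Dist
  scale p = map (λ { (w , s) → (p * w , s) })

  ⟦_⟧ : Proc n → Dist
  ⟦ ⌜ s ⌝ ⟧ = point s
  ⟦ P ⊕⟨ p ⟩ Q ⟧ = scale (val p) ⟦ P ⟧ ++ scale (1ℚ - val p) ⟦ Q ⟧

  _□ᴰ_ : Dist → SProc n → Dist
  Δ □ᴰ t = map (λ { (w , s) → (w , s □ˢ t) }) Δ

  _□ᴰ′_ : SProc n → Dist → Dist
  t □ᴰ′ Δ = map (λ { (w , s) → (w , t □ˢ s) }) Δ

  data Label : Set where
    τ   : Label
    act : Fin n → Label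

  data _—[_]→_ : SProc n → Label → Dist → Set where
    pre  : ∀ {a P} → (a · P) —[ act a ]→ ⟦ P ⟧
    intˡ : ∀ {P Q} → (P ⊓ˢ Q) —[ τ ]→ ⟦ P ⟧
    intʳ : ∀ {P Q} → (P ⊓ˢ Q) —[ τ ]→ ⟦ Q ⟧
    extˡ : ∀ {s₁ s₂ a Δ} → s₁ —[ act a ]→ Δ → (s₁ □ˢ s₂) —[ act a ]→ Δ
    extʳ : ∀ {s₁ s₂ a Δ} → s₂ —[ act a ]→ Δ → (s₁ □ˢ s₂) —[ act a ]→ Δ
    extτˡ : ∀ {s₁ s₂ Δ} → s₁ —[ τ ]→ Δ → (s₁ □ˢ s₂) —[ τ ]→ (Δ □ᴰ s₂)
    extτʳ : ∀ {s₁ s₂ Δ} → s₂ —[ τ ]→ Δ → (s₁ □ˢ s₂) —[ τ ]→ (s₁ □ᴰ′ Δ)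

  Lift : ∀ {ℓ} → (SProc n → Dist → Set ℓ) → Dist → Dist → Set ℓ
  Lift R Δ Θ =
    Σ (List (ℚ × SProc n × Dist)) λ L →
      All (λ { (p , s , Φ) → 0ℚ ≤ p × R s Φ }) L
      × foldr (λ { (p , _ , _) r → p + r }) 0ℚ L ≡ 1ℚ
      × Δ ≈ map (λ { (p , s , _) → (p , s) }) L
      × Θ ≈ concatMap (λ { (p , _ , Φ) → scale p Φ }) L

  _—τ̂→_ : SProc n → Dist → Set
  s —τ̂→ Δ = (s —[ τ ]→ Δ) ⊎ (Δ ≈ point s)

  _⟹τ̂_ : Dist → Dist → Set
  _⟹τ̂_ = Star (Lift _—τ̂→_)

  _⟹[_]_ : Dist → Label → Dist → Set
  Δ ⟹[ τ ] Θ = Δ ⟹τ̂ Θ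
  Δ ⟹[ act a ] Θ =
    ∃[ Δ₁ ] ∃[ Δ₂ ] (Δ ⟹τ̂ Δ₁ × Lift (λ s Φ → s —[ act a ]→ Φ) Δ₁ Δ₂ × Δ₂ ⟹τ̂ Θ)

  IsSimulation : (SProc n → Dist → Set) → Set
  IsSimulation R =
    (∀ {s Θ} → R s Θ → IsDist Θ)
    × (∀ {s Θ α Δ} → R s Θ → s —[ α ]→ Δ →
         ∃[ Θ′ ] (Θ ⟹[ α ] Θ′ × Lift R Δ Θ′))

  _◁S_ : SProc n → Dist → Set₁
  s ◁S Θ = ∃[ R ] (IsSimulation R × R s Θ)

  _⊑S_ : Proc n → Proc n → Set₁
  P ⊑S Q = ∃[ Θ ] (⟦ Q ⟧ ⟹τ̂ Θ × Lift _◁S_ ⟦ P ⟧ Θ)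

  data _=E_ : Proc n → Proc n → Set where
    P1 : ∀ {P p} → (P ⊕⟨ p ⟩ P) =E P
    P2 : ∀ {P Q p p′} → val p′ ≡ 1ℚ - val p → (P ⊕⟨ p ⟩ Q) =E (Q ⊕⟨ p′ ⟩ P)
    P3 : ∀ {P Q R p q r s} →
         val r ≡ val p * val q →
         val s * (1ℚ - val p * val q) ≡ (1ℚ - val p) * val q →
         ((P ⊕⟨ p ⟩ Q) ⊕⟨ q ⟩ R) =E (P ⊕⟨ r ⟩ (Q ⊕⟨ s ⟩ R))
    I1 : ∀ {P} → (P ⊓ P) =E P
    I2 : ∀ {P Q} → (P ⊓ Q) =E (Q ⊓ P)
    I3 : ∀ {P Q R} → ((P ⊓ Q) ⊓ R) =E (P ⊓ (Q ⊓ R))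
    E1 : ∀ {P} → (P □ 𝟎) =E P
    E2 : ∀ {P Q} → (P □ Q) =E (Q □ P)
    E3 : ∀ {P Q R} → ((P □ Q) □ R) =E (P □ (Q □ R))
    EI : ∀ {a P Q} → ((a ∙ P) □ (a ∙ Q)) =E ((a ∙ P) ⊓ (a ∙ Q))
    D1 : ∀ {P Q R p} → (P □ (Q ⊕⟨ p ⟩ R)) =E ((P □ Q) ⊕⟨ p ⟩ (P □ R))
    D2 : ∀ {a P Q R} → ((a ∙ P) □ (Q ⊓ R)) =E (((a ∙ P) □ Q) ⊓ ((a ∙ P) □ R))
    D3 : ∀ {P₁ P₂ Q₁ Q₂} →
         ((P₁ ⊓ P₂) □ (Q₁ ⊓ Q₂)) =E
         ((P₁ □ (Q₁ ⊓ Q₂)) ⊓ ((P₂ □ (Q₁ ⊓ Q₂))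
            ⊓ (((P₁ ⊓ P₂) □ Q₁) ⊓ ((P₁ ⊓ P₂) □ Q₂))))
    May0 : ∀ {a b P Q} → ((a ∙ P) □ (b ∙ Q)) =E ((a ∙ P) ⊓ (b ∙ Q))

  data _⊑May_ : Proc n → Proc n → Set where
    refl′ : ∀ {P} → P ⊑May P
    trans′ : ∀ {P Q R} → P ⊑May Q → Q ⊑May R → P ⊑May R
    eq→ : ∀ {P Q} → P =E Q → P ⊑May Q
    eq← : ∀ {P Q} → P =E Q → Q ⊑May P
    May1 : ∀ {P Q} → P ⊑May (P ⊓ Q)
    May2 : ∀ {P} → 𝟎 ⊑May P
    May3 : ∀ {a P Q p} → (a ∙ (P ⊕⟨ p ⟩ Q)) ⊑May ((a ∙ P) ⊕⟨ p ⟩ (a ∙ Q))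
    mono-∙ : ∀ {a P P′} → P ⊑May P′ → (a ∙ P) ⊑May (a ∙ P′)
    mono-⊓ : ∀ {P P′ Q Q′} → P ⊑May P′ → Q ⊑May Q′ → (P ⊓ Q) ⊑May (P′ ⊓ Q′)
    mono-□ : ∀ {P P′ Q Q′} → P ⊑May P′ → Q ⊑May Q′ → (P □ Q) ⊑May (P′ □ Q′)
    mono-⊕ : ∀ {P P′ Q Q′ p} → P ⊑May P′ → Q ⊑May Q′ →
             (P ⊕⟨ p ⟩ Q) ⊑May (P′ ⊕⟨ p ⟩ Q′)

-- The probabilistic axioms P1–P3 are complete for distributional equality:
-- every process is provably equal to the convex combination of the states in
-- its distribution, and such combinations can be permuted and merged into a
-- normal form.  A state-based process equals the internal choice of its
-- transitions, a visible step a to Δ contributing a.Δ (expansion law, from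
-- D2, D3, May0 and E1); each such branch lies below the state.  Hence a weak
-- τ-transition Δ ⟹ Θ only descends in the preorder, and so does a weak
-- a-transition Θ ⟹ Θ′ from a.Θ′ once May3 pushes the prefix into ⊕.  If
-- s ◁S Θ, each branch of s is matched by such a weak transition, and
-- induction on the size of s (transitions strictly shrink states) places
-- every branch, hence s, below Θ; monotonicity of ⊕ lifts this to
-- distributions.

module Submission where

open import Data.Nat using (ℕ; suc; s≤s)
import Data.Nat as ℕ
import Data.Nat.Properties as ℕP
open import Data.Rational hiding (_⊓_; _⊔_)
open import Data.Rational.Properties
open import Data.Product using (Σ; _×_; _,_; proj₁; proj₂)
open import Data.Sum using (inj₁; inj₂)
open import Data.List using (List; []; _∷_; _++_; map; concatMap; foldr; length)
open import Data.List.Properties using (map-++; ++-identityʳ)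
open import Data.List.Relation.Unary.All using (All; []; _∷_; lookup)
import Data.List.Relation.Unary.All.Properties as All
open import Data.List.Relation.Unary.Any using (Any; here; there)
import Data.List.Relation.Unary.Any.Properties as Any
open import Data.List.Membership.Propositional using (_∈_)
open import Data.List.Membership.Propositional.Properties using (∈-map⁺; ∈-map⁻; ∈-++⁺ˡ; ∈-++⁺ʳ)
open import Data.Empty using (⊥-elim)
open import Function using (_∘_)
open import Relation.Binary.PropositionalEquality
open import Relation.Binary.Bundles using (Preorder)
import Relation.Binary.Reasoning.Preorder
open import Relation.Binary.Construct.Closure.ReflexiveTransitive using (ε; _◅_)
open import Induction.WellFounded using (Acc; acc)
open import Data.Nat.Induction using (<-wellFounded)
open import Relation.Nullary using (Dec; yes; no)
open import Relation.Nullary.Decidable using (toWitness; recompute)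
open import Relation.Nullary.Decidable.Core using (dec⇒maybe)
open import Tactic.RingSolver using (solve-∀)
open import Tactic.RingSolver.Core.AlmostCommutativeRing using (AlmostCommutativeRing; fromCommutativeRing)
open import Defs

ℚ-ring : AlmostCommutativeRing _ _
ℚ-ring = fromCommutativeRing +-*-commutativeRing (λ x → dec⇒maybe (0ℚ ≟ x))

>0⇒≢0 : ∀ {x} → 0ℚ < x → x ≢ 0ℚ
>0⇒≢0 x>0 x≡0 = <⇒≢ x>0 (sym x≡0)

≥0∧≢0⇒>0 : ∀ {x} → 0ℚ ≤ x → x ≢ 0ℚ → 0ℚ < x
≥0∧≢0⇒>0 {x} x≥0 x≢0 with 0ℚ <? x
... | yes x>0 = x>0
... | no x≯0 = ⊥-elim (x≢0 (≤-antisym (≮⇒≥ x≯0) x≥0))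

+-pos : ∀ {x y} → 0ℚ < x → 0ℚ < y → 0ℚ < x + y
+-pos {x} {y} x>0 y>0 = subst (_< x + y) (+-identityʳ 0ℚ) (+-mono-< x>0 y>0)

+-nonNeg : ∀ {x y} → 0ℚ ≤ x → 0ℚ ≤ y → 0ℚ ≤ x + y
+-nonNeg {x} {y} x≥0 y≥0 = subst (_≤ x + y) (+-identityʳ 0ℚ) (+-mono-≤ x≥0 y≥0)

*-nonNeg : ∀ {x y} → 0ℚ ≤ x → 0ℚ ≤ y → 0ℚ ≤ x * y
*-nonNeg {x} {y} x≥0 y≥0 =
  nonNegative⁻¹ (x * y) {{nonNeg*nonNeg⇒nonNeg x {{nonNegative x≥0}} y {{nonNegative y≥0}}}}

x+y≡0⇒x≡0 : ∀ {x y} → 0ℚ ≤ x → 0ℚ ≤ y → x + y ≡ 0ℚ → x ≡ 0ℚ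
x+y≡0⇒x≡0 {x} {y} x≥0 y≥0 x+y≡0 =
  ≤-antisym (subst (x ≤_) x+y≡0 (subst (_≤ x + y) (+-identityʳ x) (+-monoʳ-≤ x y≥0))) x≥0

x+y≡0⇒y≡0 : ∀ {x y} → 0ℚ ≤ x → 0ℚ ≤ y → x + y ≡ 0ℚ → y ≡ 0ℚ
x+y≡0⇒y≡0 {x} {y} x≥0 y≥0 x+y≡0 = x+y≡0⇒x≡0 y≥0 x≥0 (trans (+-comm y x) x+y≡0)

*-cancelʳ-≡ : ∀ x y z → z ≢ 0ℚ → x * z ≡ y * z → x ≡ y
*-cancelʳ-≡ x y z z≢0 eq = begin
    x                 ≡⟨ sym (*-identityʳ x) ⟩
    x * 1ℚ            ≡⟨ cong (x *_) (sym (*-inverseʳ z)) ⟩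
    x * (z * 1/ z)    ≡⟨ sym (*-assoc x z (1/ z)) ⟩
    x * z * 1/ z      ≡⟨ cong (_* 1/ z) eq ⟩
    y * z * 1/ z      ≡⟨ *-assoc y z (1/ z) ⟩
    y * (z * 1/ z)    ≡⟨ cong (y *_) (*-inverseʳ z) ⟩
    y * 1ℚ            ≡⟨ *-identityʳ y ⟩
    y                 ∎
  where open ≡-Reasoning
        instance
          z≢0′ : NonZero z
          z≢0′ = ≢-nonZero z≢0

x*y≡0⇒y≡0 : ∀ {x y} → x ≢ 0ℚ → x * y ≡ 0ℚ → y ≡ 0ℚ
x*y≡0⇒y≡0 {x} {y} x≢0 xy≡0 = *-cancelʳ-≡ y 0ℚ x x≢0 (trans (*-comm y x) (trans xy≡0 (sym (*-zeroˡ x))))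

x+y-x≡y : ∀ x y → (x + y) - x ≡ y
x+y-x≡y = solve-∀ ℚ-ring

+-cancelˡ-≡ : ∀ x y z → x + y ≡ x + z → y ≡ z
+-cancelˡ-≡ x y z eq = trans (sym (x+y-x≡y x y)) (trans (cong (_- x) eq) (x+y-x≡y x z))

*-1/-cancelʳ : ∀ x y .{{_ : NonZero y}} → x * 1/ y * y ≡ x
*-1/-cancelʳ x y = trans (*-assoc x _ _) (trans (cong (x *_) (*-inverseˡ y)) (*-identityʳ x))

val>0 : ∀ (p : Prob) → 0ℚ < val p
val>0 (prob v v>0 _) = recompute (0ℚ <? v) v>0

1-val>0 : ∀ (p : Prob) → 0ℚ < 1ℚ - val p
1-val>0 (prob v _ v<1) = subst (_< 1ℚ - v) (+-inverseʳ v) (+-monoˡ-< (- v) (recompute (v <? 1ℚ) v<1))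

½-prob : Prob
½-prob = prob ½ (toWitness {a? = 0ℚ <? ½} _) (toWitness {a? = ½ <? 1ℚ} _)

-- x / (x + y); the junk value ½ for non-positive arguments is never reached.
ratio : ℚ → ℚ → Prob
ratio x y with 0ℚ <? x | 0ℚ <? y
... | yes x>0 | yes y>0 = prob (x * 1/ (x + y)) ratio>0 ratio<1
  where
  x+y>0 : 0ℚ < x + y
  x+y>0 = +-pos x>0 y>0
  instance
    x+y≢0 : NonZero (x + y)
    x+y≢0 = >-nonZero x+y>0
  ratio>0 : 0ℚ < x * 1/ (x + y)
  ratio>0 = positive⁻¹ _ {{pos*pos⇒pos x {{positive x>0}} _ {{1/pos⇒pos (x + y) {{positive x+y>0}}}}}}
  ratio<1 : x * 1/ (x + y) < 1ℚ
  ratio<1 = *-cancelʳ-<-nonNeg (x + y) {{nonNegative (<⇒≤ x+y>0)}}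
    (subst₂ _<_ (sym (*-1/-cancelʳ x (x + y))) (sym (*-identityˡ (x + y)))
      (subst (_< x + y) (+-identityʳ x) (+-monoʳ-< x y>0)))
... | _ | _ = ½-prob

ratio-spec : ∀ {x y} → 0ℚ < x → 0ℚ < y → val (ratio x y) * (x + y) ≡ x
ratio-spec {x} {y} x>0 y>0 with 0ℚ <? x | 0ℚ <? y
... | yes x>0′ | yes y>0′ = *-1/-cancelʳ x (x + y) {{>-nonZero (+-pos x>0′ y>0′)}}
... | no x≯0 | _ = ⊥-elim (x≯0 x>0)
... | yes _ | no y≯0 = ⊥-elim (y≯0 y>0)

ratio-unique : ∀ {x y} z → 0ℚ < x → 0ℚ < y → z * (x + y) ≡ x → val (ratio x y) ≡ z
ratio-unique {x} {y} z x>0 y>0 eq =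
  *-cancelʳ-≡ _ z (x + y) (>0⇒≢0 (+-pos x>0 y>0)) (trans (ratio-spec x>0 y>0) (sym eq))

module _ {X : Set} where

  weight : List (ℚ × X) → ℚ
  weight = foldr (λ e r → proj₁ e + r) 0ℚ

  NonNegWeights : List (ℚ × X) → Set
  NonNegWeights = All (λ e → 0ℚ ≤ proj₁ e)

  scaleʷ : ℚ → List (ℚ × X) → List (ℚ × X)
  scaleʷ c = map (λ { (w , x) → (c * w , x) })

  weight-nonNeg : ∀ {L} → NonNegWeights L → 0ℚ ≤ weight L
  weight-nonNeg [] = ≤-refl
  weight-nonNeg (w≥0 ∷ L≥0) = +-nonNeg w≥0 (weight-nonNeg L≥0)

  weight-++ : ∀ K L → weight (K ++ L) ≡ weight K + weight L
  weight-++ [] L = sym (+-identityˡ _)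
  weight-++ ((w , _) ∷ K) L = trans (cong (w +_) (weight-++ K L)) (sym (+-assoc w _ _))

  weight-scaleʷ : ∀ c L → weight (scaleʷ c L) ≡ c * weight L
  weight-scaleʷ c [] = sym (*-zeroʳ c)
  weight-scaleʷ c ((w , _) ∷ L) = trans (cong (c * w +_) (weight-scaleʷ c L)) (sym (*-distribˡ-+ c w _))

  scaleʷ-nonNeg : ∀ {c L} → 0ℚ ≤ c → NonNegWeights L → NonNegWeights (scaleʷ c L)
  scaleʷ-nonNeg c≥0 [] = []
  scaleʷ-nonNeg c≥0 (w≥0 ∷ L≥0) = *-nonNeg c≥0 w≥0 ∷ scaleʷ-nonNeg c≥0 L≥0

module _ {n : ℕ} where

  mass-++ : ∀ s (Δ Θ : Dist {n}) → mass s (Δ ++ Θ) ≡ mass s Δ + mass s Θ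
  mass-++ s [] Θ = sym (+-identityˡ _)
  mass-++ s ((w , t) ∷ Δ) Θ with t ≟S s
  ... | yes _ = trans (cong (w +_) (mass-++ s Δ Θ)) (sym (+-assoc w _ _))
  ... | no _ = mass-++ s Δ Θ

  mass-scale : ∀ s c (Δ : Dist {n}) → mass s (scale c Δ) ≡ c * mass s Δ
  mass-scale s c [] = sym (*-zeroʳ c)
  mass-scale s c ((w , t) ∷ Δ) with t ≟S s
  ... | yes _ = trans (cong (c * w +_) (mass-scale s c Δ)) (sym (*-distribˡ-+ c w _))
  ... | no _ = mass-scale s c Δ

  mass-nonNeg : ∀ s {Δ : Dist {n}} → NonNegWeights Δ → 0ℚ ≤ mass s Δ
  mass-nonNeg s {[]} [] = ≤-refl
  mass-nonNeg s {(w , t) ∷ Δ} (w≥0 ∷ Δ≥0) with t ≟S s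
  ... | yes _ = +-nonNeg w≥0 (mass-nonNeg s Δ≥0)
  ... | no _ = mass-nonNeg s Δ≥0

  mass-⊕ : ∀ s P p Q → mass s ⟦ P ⊕⟨ p ⟩ Q ⟧ ≡ val p * mass s ⟦ P ⟧ + (1ℚ - val p) * mass s ⟦ Q ⟧
  mass-⊕ s P p Q = trans (mass-++ s (scale (val p) ⟦ P ⟧) _)
    (cong₂ _+_ (mass-scale s (val p) ⟦ P ⟧) (mass-scale s (1ℚ - val p) ⟦ Q ⟧))

  ⟦⟧-nonNeg : ∀ (P : Proc n) → NonNegWeights ⟦ P ⟧
  ⟦⟧-nonNeg ⌜ s ⌝ = nonNegative⁻¹ 1ℚ ∷ []
  ⟦⟧-nonNeg (P ⊕⟨ p ⟩ Q) = All.++⁺ (scaleʷ-nonNeg (<⇒≤ (val>0 p)) (⟦⟧-nonNeg P))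
                                    (scaleʷ-nonNeg (<⇒≤ (1-val>0 p)) (⟦⟧-nonNeg Q))

  ⟦⟧-weight : ∀ (P : Proc n) → weight ⟦ P ⟧ ≡ 1ℚ
  ⟦⟧-weight ⌜ s ⌝ = +-identityʳ 1ℚ
  ⟦⟧-weight (P ⊕⟨ p ⟩ Q) = begin
      weight (scale (val p) ⟦ P ⟧ ++ scale (1ℚ - val p) ⟦ Q ⟧)
        ≡⟨ weight-++ (scale (val p) ⟦ P ⟧) _ ⟩
      weight (scale (val p) ⟦ P ⟧) + weight (scale (1ℚ - val p) ⟦ Q ⟧)
        ≡⟨ cong₂ _+_ (weight-scaleʷ (val p) ⟦ P ⟧) (weight-scaleʷ (1ℚ - val p) ⟦ Q ⟧) ⟩
      val p * weight ⟦ P ⟧ + (1ℚ - val p) * weight ⟦ Q ⟧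
        ≡⟨ cong₂ (λ a b → val p * a + (1ℚ - val p) * b) (⟦⟧-weight P) (⟦⟧-weight Q) ⟩
      val p * 1ℚ + (1ℚ - val p) * 1ℚ
        ≡⟨ convex-1 (val p) ⟩
      1ℚ ∎
    where
    open ≡-Reasoning
    convex-1 : ∀ q → q * 1ℚ + (1ℚ - q) * 1ℚ ≡ 1ℚ
    convex-1 = solve-∀ ℚ-ring

module _ {n : ℕ} where

  ⊑May-preorder : Preorder _ _ _
  ⊑May-preorder = record
    { Carrier = Proc n
    ; _≈_ = _≡_
    ; _≲_ = _⊑May_
    ; isPreorder = record { isEquivalence = isEquivalence ; reflexive = λ { refl → refl′ } ; trans = trans′ }
    }

  module ⊑-Reasoning = Relation.Binary.Reasoning.Preorder ⊑May-preorder

  infix 4 _≅_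
  _≅_ : Proc n → Proc n → Set
  P ≅ Q = P ⊑May Q × Q ⊑May P

  ≅-refl : ∀ {P : Proc n} → P ≅ P
  ≅-refl = refl′ , refl′

  ≅-reflexive : ∀ {P Q : Proc n} → P ≡ Q → P ≅ Q
  ≅-reflexive refl = ≅-refl

  ≅-sym : ∀ {P Q : Proc n} → P ≅ Q → Q ≅ P
  ≅-sym (P⊑Q , Q⊑P) = Q⊑P , P⊑Q

  ≅-trans : ∀ {P Q R : Proc n} → P ≅ Q → Q ≅ R → P ≅ R
  ≅-trans (P⊑Q , Q⊑P) (Q⊑R , R⊑Q) = trans′ P⊑Q Q⊑R , trans′ R⊑Q Q⊑P

  =E⇒≅ : ∀ {P Q : Proc n} → P =E Q → P ≅ Q
  =E⇒≅ P=Q = eq→ P=Q , eq← P=Q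

  ⊕-cong : ∀ {P P′ Q Q′ : Proc n} {p} → P ≅ P′ → Q ≅ Q′ → (P ⊕⟨ p ⟩ Q) ≅ (P′ ⊕⟨ p ⟩ Q′)
  ⊕-cong (P⊑P′ , P′⊑P) (Q⊑Q′ , Q′⊑Q) = mono-⊕ P⊑P′ Q⊑Q′ , mono-⊕ P′⊑P Q′⊑Q

  ⊕-cong-prob : ∀ {P Q : Proc n} {p q} → val p ≡ val q → (P ⊕⟨ p ⟩ Q) ≅ (P ⊕⟨ q ⟩ Q)
  ⊕-cong-prob {p = prob v _ _} {prob .v _ _} refl = ≅-refl

  ⊕-comm-ratio : ∀ {P Q : Proc n} {x y} → 0ℚ < x → 0ℚ < y →
                 (P ⊕⟨ ratio x y ⟩ Q) ≅ (Q ⊕⟨ ratio y x ⟩ P)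
  ⊕-comm-ratio {x = x} {y} x>0 y>0 = =E⇒≅ (P2 (ratio-unique _ y>0 x>0 (begin
      (1ℚ - p) * (y + x)    ≡⟨ distrib p x y ⟩
      (x + y) - p * (x + y) ≡⟨ cong (λ t → (x + y) - t) (ratio-spec x>0 y>0) ⟩
      (x + y) - x           ≡⟨ x+y-x≡y x y ⟩
      y                     ∎)))
    where
    open ≡-Reasoning
    p : ℚ
    p = val (ratio x y)
    distrib : ∀ p x y → (1ℚ - p) * (y + x) ≡ (x + y) - p * (x + y)
    distrib = solve-∀ ℚ-ring

  ⊕-assoc-ratio : ∀ {P Q R : Proc n} {x y z} → 0ℚ < x → 0ℚ < y → 0ℚ < z →
                  ((P ⊕⟨ ratio x y ⟩ Q) ⊕⟨ ratio (x + y) z ⟩ R)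
                    ≅ (P ⊕⟨ ratio x (y + z) ⟩ (Q ⊕⟨ ratio y z ⟩ R))
  ⊕-assoc-ratio {x = x} {y} {z} x>0 y>0 z>0 = =E⇒≅ (P3 outer inner)
    where
    open ≡-Reasoning
    p : ℚ
    p = val (ratio x y)
    q : ℚ
    q = val (ratio (x + y) z)
    s : ℚ
    s = val (ratio y z)
    D : ℚ
    D = (x + y) + z
    q*D≡x+y : q * D ≡ x + y
    q*D≡x+y = ratio-spec (+-pos x>0 y>0) z>0
    p*q*D≡x : p * (q * D) ≡ x
    p*q*D≡x = trans (cong (p *_) q*D≡x+y) (ratio-spec x>0 y>0)
    reassoc : ∀ p q x y z → (p * q) * (x + (y + z)) ≡ p * (q * ((x + y) + z))
    reassoc = solve-∀ ℚ-ring
    outer : val (ratio x (y + z)) ≡ p * q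
    outer = ratio-unique (p * q) x>0 (+-pos y>0 z>0) (trans (reassoc p q x y z) p*q*D≡x)
    expandˡ : ∀ s pq D → s * (1ℚ - pq) * D ≡ s * (D - pq * D)
    expandˡ = solve-∀ ℚ-ring
    expandʳ : ∀ p q D → (1ℚ - p) * q * D ≡ q * D - p * (q * D)
    expandʳ = solve-∀ ℚ-ring
    x+y+z-x : ∀ x y z → ((x + y) + z) - x ≡ y + z
    x+y+z-x = solve-∀ ℚ-ring
    inner : s * (1ℚ - p * q) ≡ (1ℚ - p) * q
    inner = *-cancelʳ-≡ _ _ D (>0⇒≢0 (+-pos (+-pos x>0 y>0) z>0)) (begin
      s * (1ℚ - p * q) * D  ≡⟨ expandˡ s (p * q) D ⟩
      s * (D - p * q * D)   ≡⟨ cong (λ t → s * (D - t)) (trans (*-assoc p q D) p*q*D≡x) ⟩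
      s * (D - x)           ≡⟨ cong (s *_) (x+y+z-x x y z) ⟩
      s * (y + z)           ≡⟨ ratio-spec y>0 z>0 ⟩
      y                     ≡⟨ sym (x+y-x≡y x y) ⟩
      (x + y) - x           ≡⟨ cong₂ _-_ (sym q*D≡x+y) (sym p*q*D≡x) ⟩
      q * D - p * (q * D)   ≡⟨ sym (expandʳ p q D) ⟩
      (1ℚ - p) * q * D      ∎)

module _ {n : ℕ} where

  -- T weighted w against M weighted r.  The zero tests are arguments, so
  -- that lemmas can case on them instead of abstracting over them.
  mix₂ : (w : ℚ) → Proc n → (r : ℚ) → Dec (w ≡ 0ℚ) → Dec (r ≡ 0ℚ) → Proc n → Proc n
  mix₂ w T r (yes _) _ M = M
  mix₂ w T r (no _) (yes _) M = T
  mix₂ w T r (no _) (no _) M = T ⊕⟨ ratio w r ⟩ M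

  mix : List (ℚ × Proc n) → Proc n
  mix [] = 𝟎
  mix ((w , T) ∷ L) = mix₂ w T (weight L) (w ≟ 0ℚ) (weight L ≟ 0ℚ) (mix L)

  mixMass : SProc n → List (ℚ × Proc n) → ℚ
  mixMass s = foldr (λ e r → proj₁ e * mass s ⟦ proj₂ e ⟧ + r) 0ℚ

  mixMass-weight≡0 : ∀ s {L} → NonNegWeights L → weight L ≡ 0ℚ → mixMass s L ≡ 0ℚ
  mixMass-weight≡0 s [] _ = refl
  mixMass-weight≡0 s {(w , T) ∷ L} (w≥0 ∷ L≥0) eq =
    trans (cong₂ (λ a b → a * mass s ⟦ T ⟧ + b) (x+y≡0⇒x≡0 w≥0 (weight-nonNeg L≥0) eq)
                 (mixMass-weight≡0 s L≥0 (x+y≡0⇒y≡0 w≥0 (weight-nonNeg L≥0) eq)))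
      (trans (+-identityʳ _) (*-zeroˡ (mass s ⟦ T ⟧)))

  mass-mix₂ : ∀ s {w T r} dw dr {M μ} → 0ℚ ≤ w → 0ℚ ≤ r → (r ≡ 0ℚ → μ ≡ 0ℚ) → mass s ⟦ M ⟧ * r ≡ μ →
              mass s ⟦ mix₂ w T r dw dr M ⟧ * (w + r) ≡ w * mass s ⟦ T ⟧ + μ
  mass-mix₂ s {T = T} {r} (yes refl) dr {M} {μ} _ _ _ eq = begin
      mass s ⟦ M ⟧ * (0ℚ + r)    ≡⟨ cong (mass s ⟦ M ⟧ *_) (+-identityˡ r) ⟩
      mass s ⟦ M ⟧ * r           ≡⟨ eq ⟩
      μ                          ≡⟨ sym (+-identityˡ μ) ⟩
      0ℚ + μ                     ≡⟨ cong (_+ μ) (sym (*-zeroˡ (mass s ⟦ T ⟧))) ⟩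
      0ℚ * mass s ⟦ T ⟧ + μ      ∎
    where open ≡-Reasoning
  mass-mix₂ s {w} {T} (no _) (yes refl) {μ = μ} _ _ μ≡0 _ = begin
      mass s ⟦ T ⟧ * (w + 0ℚ)    ≡⟨ cong (mass s ⟦ T ⟧ *_) (+-identityʳ w) ⟩
      mass s ⟦ T ⟧ * w           ≡⟨ *-comm _ w ⟩
      w * mass s ⟦ T ⟧           ≡⟨ sym (+-identityʳ _) ⟩
      w * mass s ⟦ T ⟧ + 0ℚ      ≡⟨ cong (w * mass s ⟦ T ⟧ +_) (sym (μ≡0 refl)) ⟩
      w * mass s ⟦ T ⟧ + μ       ∎
    where open ≡-Reasoning
  mass-mix₂ s {w} {T} {r} (no w≢0) (no r≢0) {M} {μ} w≥0 r≥0 _ eq = begin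
      mass s ⟦ T ⊕⟨ ratio w r ⟩ M ⟧ * (w + r)
        ≡⟨ cong (_* (w + r)) (mass-⊕ s T (ratio w r) M) ⟩
      (q * mass s ⟦ T ⟧ + (1ℚ - q) * mass s ⟦ M ⟧) * (w + r)
        ≡⟨ distrib q _ _ (w + r) ⟩
      (q * (w + r)) * mass s ⟦ T ⟧ + ((w + r) - q * (w + r)) * mass s ⟦ M ⟧
        ≡⟨ cong (λ x → x * mass s ⟦ T ⟧ + ((w + r) - x) * mass s ⟦ M ⟧)
                (ratio-spec (≥0∧≢0⇒>0 w≥0 w≢0) (≥0∧≢0⇒>0 r≥0 r≢0)) ⟩
      w * mass s ⟦ T ⟧ + ((w + r) - w) * mass s ⟦ M ⟧
        ≡⟨ cong (λ x → w * mass s ⟦ T ⟧ + x * mass s ⟦ M ⟧) (x+y-x≡y w r) ⟩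
      w * mass s ⟦ T ⟧ + r * mass s ⟦ M ⟧
        ≡⟨ cong (w * mass s ⟦ T ⟧ +_) (trans (*-comm r _) eq) ⟩
      w * mass s ⟦ T ⟧ + μ ∎
    where
    open ≡-Reasoning
    q : ℚ
    q = val (ratio w r)
    distrib : ∀ q mT mM D → (q * mT + (1ℚ - q) * mM) * D ≡ (q * D) * mT + (D - q * D) * mM
    distrib = solve-∀ ℚ-ring

  mass-mix-scaled : ∀ s {L} → NonNegWeights L → mass s ⟦ mix L ⟧ * weight L ≡ mixMass s L
  mass-mix-scaled s {[]} [] = *-zeroʳ (mass s ⟦ 𝟎 ⟧)
  mass-mix-scaled s {(w , T) ∷ L} (w≥0 ∷ L≥0) =
    mass-mix₂ s (w ≟ 0ℚ) (weight L ≟ 0ℚ) w≥0 (weight-nonNeg L≥0)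
      (mixMass-weight≡0 s L≥0) (mass-mix-scaled s L≥0)

  mass-mix : ∀ s {L} → NonNegWeights L → weight L ≡ 1ℚ → mass s ⟦ mix L ⟧ ≡ mixMass s L
  mass-mix s {L} L≥0 L≡1 =
    trans (sym (*-identityʳ _)) (trans (cong (mass s ⟦ mix L ⟧ *_) (sym L≡1)) (mass-mix-scaled s L≥0))

  mix₂-cong : ∀ {w w′ T r r′} dw dw′ dr dr′ {M M′} →
              w ≡ w′ → r ≡ r′ → M ≅ M′ → mix₂ w T r dw dr M ≅ mix₂ w′ T r′ dw′ dr′ M′
  mix₂-cong (yes _) (yes _) _ _ refl refl M≅M′ = M≅M′
  mix₂-cong (yes w≡0) (no w≢0) _ _ refl refl _ = ⊥-elim (w≢0 w≡0)
  mix₂-cong (no w≢0) (yes w≡0) _ _ refl refl _ = ⊥-elim (w≢0 w≡0)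
  mix₂-cong (no _) (no _) (yes _) (yes _) refl refl _ = ≅-refl
  mix₂-cong (no _) (no _) (yes r≡0) (no r≢0) refl refl _ = ⊥-elim (r≢0 r≡0)
  mix₂-cong (no _) (no _) (no r≢0) (yes r≡0) refl refl _ = ⊥-elim (r≢0 r≡0)
  mix₂-cong (no _) (no _) (no _) (no _) refl refl M≅M′ = ⊕-cong ≅-refl M≅M′

  mix₂-mono : ∀ {w T T′ r r′} dw dw′ dr dr′ {M M′} → r ≡ r′ →
              (w ≢ 0ℚ → T ⊑May T′) → M ⊑May M′ → mix₂ w T r dw dr M ⊑May mix₂ w T′ r′ dw′ dr′ M′
  mix₂-mono (yes _) (yes _) _ _ refl _ M⊑M′ = M⊑M′
  mix₂-mono (yes w≡0) (no w≢0) _ _ refl _ _ = ⊥-elim (w≢0 w≡0)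
  mix₂-mono (no w≢0) (yes w≡0) _ _ refl _ _ = ⊥-elim (w≢0 w≡0)
  mix₂-mono (no w≢0) (no _) (yes _) (yes _) refl T⊑T′ _ = T⊑T′ w≢0
  mix₂-mono (no _) (no _) (yes r≡0) (no r≢0) refl _ _ = ⊥-elim (r≢0 r≡0)
  mix₂-mono (no _) (no _) (no r≢0) (yes r≡0) refl _ _ = ⊥-elim (r≢0 r≡0)
  mix₂-mono (no w≢0) (no _) (no _) (no _) refl T⊑T′ M⊑M′ = mono-⊕ (T⊑T′ w≢0) M⊑M′

  mix₂-zero : ∀ {w T r} dw dr {M} → w ≡ 0ℚ → mix₂ w T r dw dr M ≡ M
  mix₂-zero (yes _) _ _ = refl
  mix₂-zero (no w≢0) _ w≡0 = ⊥-elim (w≢0 w≡0)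

  mix₂-swap : ∀ {w v r X Y M} dw dv+r dv dr dw+r dr′ → 0ℚ ≤ w → 0ℚ ≤ v → 0ℚ ≤ r →
              mix₂ w X (v + r) dw dv+r (mix₂ v Y r dv dr M)
                ≅ mix₂ v Y (w + r) dv dw+r (mix₂ w X r dw dr′ M)
  mix₂-swap {r = r} (yes refl) _ dv dr dw+r _ _ _ _ =
    mix₂-cong dv dv dr dw+r refl (sym (+-identityˡ r)) ≅-refl
  mix₂-swap {r = r} (no w≢0) dv+r (yes refl) _ _ dr′ _ _ _ =
    mix₂-cong (no w≢0) (no w≢0) dv+r dr′ refl (+-identityˡ r) ≅-refl
  mix₂-swap (no _) (yes v+r≡0) (no v≢0) _ _ _ _ v≥0 r≥0 = ⊥-elim (v≢0 (x+y≡0⇒x≡0 v≥0 r≥0 v+r≡0))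
  mix₂-swap (no w≢0) (no _) (no _) _ (yes w+r≡0) _ w≥0 _ r≥0 = ⊥-elim (w≢0 (x+y≡0⇒x≡0 w≥0 r≥0 w+r≡0))
  mix₂-swap {w} {v} (no w≢0) (no _) (no v≢0) (yes refl) (no _) (yes _) w≥0 v≥0 _ =
    ≅-trans (⊕-cong-prob (cong (val ∘ ratio w) (+-identityʳ v)))
      (≅-trans (⊕-comm-ratio w>0 v>0) (⊕-cong-prob (cong (val ∘ ratio v) (sym (+-identityʳ w)))))
    where
    w>0 : 0ℚ < w
    w>0 = ≥0∧≢0⇒>0 w≥0 w≢0
    v>0 : 0ℚ < v
    v>0 = ≥0∧≢0⇒>0 v≥0 v≢0
  mix₂-swap (no _) (no _) (no _) (yes refl) (no _) (no r≢0) _ _ _ = ⊥-elim (r≢0 refl)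
  mix₂-swap (no _) (no _) (no _) (no r≢0) (no _) (yes r≡0) _ _ _ = ⊥-elim (r≢0 r≡0)
  mix₂-swap {w} {v} {r} (no w≢0) (no _) (no v≢0) (no r≢0) (no _) (no _) w≥0 v≥0 r≥0 =
    ≅-trans (≅-sym (⊕-assoc-ratio w>0 v>0 r>0))
      (≅-trans (⊕-cong (⊕-comm-ratio w>0 v>0) ≅-refl)
        (≅-trans (⊕-cong-prob (cong (λ t → val (ratio t r)) (+-comm w v))) (⊕-assoc-ratio v>0 w>0 r>0)))
    where
    w>0 : 0ℚ < w
    w>0 = ≥0∧≢0⇒>0 w≥0 w≢0
    v>0 : 0ℚ < v
    v>0 = ≥0∧≢0⇒>0 v≥0 v≢0
    r>0 : 0ℚ < r
    r>0 = ≥0∧≢0⇒>0 r≥0 r≢0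

  mix₂-merge : ∀ {w v r X M} dw dv+r dv dr dw+v dr′ → 0ℚ ≤ w → 0ℚ ≤ v → 0ℚ ≤ r →
               mix₂ w X (v + r) dw dv+r (mix₂ v X r dv dr M) ≅ mix₂ (w + v) X r dw+v dr′ M
  mix₂-merge {v = v} (yes refl) _ dv dr dw+v dr′ _ _ _ =
    mix₂-cong dv dw+v dr dr′ (sym (+-identityˡ v)) refl ≅-refl
  mix₂-merge {w} {r = r} (no w≢0) dv+r (yes refl) _ dw+v dr′ _ _ _ =
    mix₂-cong (no w≢0) dw+v dv+r dr′ (sym (+-identityʳ w)) (+-identityˡ r) ≅-refl
  mix₂-merge (no _) (yes v+r≡0) (no v≢0) _ _ _ _ v≥0 r≥0 = ⊥-elim (v≢0 (x+y≡0⇒x≡0 v≥0 r≥0 v+r≡0))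
  mix₂-merge (no w≢0) (no _) (no _) _ (yes w+v≡0) _ w≥0 v≥0 _ = ⊥-elim (w≢0 (x+y≡0⇒x≡0 w≥0 v≥0 w+v≡0))
  mix₂-merge (no _) (no _) (no _) (yes refl) (no _) (yes _) _ _ _ = =E⇒≅ P1
  mix₂-merge (no _) (no _) (no _) (yes refl) (no _) (no r≢0) _ _ _ = ⊥-elim (r≢0 refl)
  mix₂-merge (no _) (no _) (no _) (no r≢0) (no _) (yes r≡0) _ _ _ = ⊥-elim (r≢0 r≡0)
  mix₂-merge (no w≢0) (no _) (no v≢0) (no r≢0) (no _) (no _) w≥0 v≥0 r≥0 =
    ≅-trans (≅-sym (⊕-assoc-ratio (≥0∧≢0⇒>0 w≥0 w≢0) (≥0∧≢0⇒>0 v≥0 v≢0) (≥0∧≢0⇒>0 r≥0 r≢0)))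
      (⊕-cong (=E⇒≅ P1) ≅-refl)

  mix₂-split : ∀ {w a b X N M K} dw da+b da → 0ℚ ≤ w → 0ℚ ≤ a → 0ℚ < b → 0ℚ < w + a →
               (a ≢ 0ℚ → N ≅ (M ⊕⟨ ratio a b ⟩ K)) → (a ≡ 0ℚ → N ≅ K) →
               mix₂ w X (a + b) dw da+b N ≅ (mix₂ w X a dw da M ⊕⟨ ratio (w + a) b ⟩ K)
  mix₂-split {a = a} {b} (yes refl) _ _ _ _ _ w+a>0 split≢0 _ =
    ≅-trans (split≢0 λ a≡0 → >0⇒≢0 w+a>0 (trans (+-identityˡ a) a≡0))
      (⊕-cong-prob (cong (λ t → val (ratio t b)) (sym (+-identityˡ a))))
  mix₂-split {b = b} (no _) (yes 0+b≡0) (yes refl) _ _ b>0 _ _ _ =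
    ⊥-elim (>0⇒≢0 b>0 (trans (sym (+-identityˡ b)) 0+b≡0))
  mix₂-split {w} {b = b} (no _) (no _) (yes refl) _ _ _ _ _ split≡0 =
    ≅-trans (⊕-cong ≅-refl (split≡0 refl))
      (⊕-cong-prob (cong₂ (λ x y → val (ratio x y)) (sym (+-identityʳ w)) (+-identityˡ b)))
  mix₂-split (no _) (yes a+b≡0) (no _) _ a≥0 b>0 _ _ _ = ⊥-elim (>0⇒≢0 b>0 (x+y≡0⇒y≡0 a≥0 (<⇒≤ b>0) a+b≡0))
  mix₂-split (no w≢0) (no _) (no a≢0) w≥0 a≥0 b>0 _ split≢0 _ =
    ≅-trans (⊕-cong ≅-refl (split≢0 a≢0))
      (≅-sym (⊕-assoc-ratio (≥0∧≢0⇒>0 w≥0 w≢0) (≥0∧≢0⇒>0 a≥0 a≢0) b>0))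

  mix₂-scale : ∀ {c w r X N M} dcw dcr dw dr → 0ℚ < c → 0ℚ ≤ w → 0ℚ ≤ r → N ≅ M →
               mix₂ (c * w) X (c * r) dcw dcr N ≅ mix₂ w X r dw dr M
  mix₂-scale (yes _) _ (yes _) _ _ _ _ N≅M = N≅M
  mix₂-scale (yes cw≡0) _ (no w≢0) _ c>0 _ _ _ = ⊥-elim (w≢0 (x*y≡0⇒y≡0 (>0⇒≢0 c>0) cw≡0))
  mix₂-scale {c} (no cw≢0) _ (yes refl) _ _ _ _ _ = ⊥-elim (cw≢0 (*-zeroʳ c))
  mix₂-scale (no _) (yes _) (no _) (yes _) _ _ _ _ = ≅-refl
  mix₂-scale (no _) (yes cr≡0) (no _) (no r≢0) c>0 _ _ _ = ⊥-elim (r≢0 (x*y≡0⇒y≡0 (>0⇒≢0 c>0) cr≡0))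
  mix₂-scale {c} (no _) (no cr≢0) (no _) (yes refl) _ _ _ _ = ⊥-elim (cr≢0 (*-zeroʳ c))
  mix₂-scale {c} {w} {r} (no cw≢0) (no cr≢0) (no w≢0) (no r≢0) c>0 w≥0 r≥0 N≅M =
    ≅-trans (⊕-cong ≅-refl N≅M)
      (⊕-cong-prob (ratio-unique _ (≥0∧≢0⇒>0 (*-nonNeg c≥0 w≥0) cw≢0) (≥0∧≢0⇒>0 (*-nonNeg c≥0 r≥0) cr≢0)
        (trans (reassoc (val (ratio w r)) c w r)
               (cong (c *_) (ratio-spec (≥0∧≢0⇒>0 w≥0 w≢0) (≥0∧≢0⇒>0 r≥0 r≢0))))))
    where
    c≥0 : 0ℚ ≤ c
    c≥0 = <⇒≤ c>0
    reassoc : ∀ p c w r → p * (c * w + c * r) ≡ c * (p * (w + r))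
    reassoc = solve-∀ ℚ-ring

  mix₂-prefix : ∀ a {w X r r′} dw dw′ dr dr′ {M N} → r ≡ r′ →
                (r ≢ 0ℚ → (a ∙ M) ⊑May N) → w + r ≢ 0ℚ →
                (a ∙ mix₂ w X r dw dr M) ⊑May mix₂ w (a ∙ X) r′ dw′ dr′ N
  mix₂-prefix a {r = r} (yes refl) (yes _) _ _ refl aM⊑N 0+r≢0 = aM⊑N λ r≡0 → 0+r≢0 (trans (+-identityˡ r) r≡0)
  mix₂-prefix a (yes w≡0) (no w≢0) _ _ refl _ _ = ⊥-elim (w≢0 w≡0)
  mix₂-prefix a (no w≢0) (yes w≡0) _ _ refl _ _ = ⊥-elim (w≢0 w≡0)
  mix₂-prefix a (no _) (no _) (yes _) (yes _) refl _ _ = refl′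
  mix₂-prefix a (no _) (no _) (yes r≡0) (no r≢0) refl _ _ = ⊥-elim (r≢0 r≡0)
  mix₂-prefix a (no _) (no _) (no r≢0) (yes r≡0) refl _ _ = ⊥-elim (r≢0 r≡0)
  mix₂-prefix a (no _) (no _) (no r≢0) (no _) refl aM⊑N _ = trans′ May3 (mono-⊕ refl′ (aM⊑N r≢0))

  mix-cong-tail : ∀ w T K L → weight K ≡ weight L → mix K ≅ mix L → mix ((w , T) ∷ K) ≅ mix ((w , T) ∷ L)
  mix-cong-tail w T K L K≡L mixK≅mixL =
    mix₂-cong (w ≟ 0ℚ) (w ≟ 0ℚ) (weight K ≟ 0ℚ) (weight L ≟ 0ℚ) refl K≡L mixK≅mixL

  mix-swap : ∀ w X v Y L → 0ℚ ≤ w → 0ℚ ≤ v → NonNegWeights L →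
             mix ((w , X) ∷ (v , Y) ∷ L) ≅ mix ((v , Y) ∷ (w , X) ∷ L)
  mix-swap w X v Y L w≥0 v≥0 L≥0 = mix₂-swap (w ≟ 0ℚ) _ (v ≟ 0ℚ) _ _ _ w≥0 v≥0 (weight-nonNeg L≥0)

  mix-merge : ∀ w X v L → 0ℚ ≤ w → 0ℚ ≤ v → NonNegWeights L →
              mix ((w , X) ∷ (v , X) ∷ L) ≅ mix ((w + v , X) ∷ L)
  mix-merge w X v L w≥0 v≥0 L≥0 = mix₂-merge (w ≟ 0ℚ) _ (v ≟ 0ℚ) _ _ _ w≥0 v≥0 (weight-nonNeg L≥0)

  mix-weight≡0-++ : ∀ K L → NonNegWeights K → weight K ≡ 0ℚ → mix (K ++ L) ≡ mix L
  mix-weight≡0-++ [] L _ _ = refl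
  mix-weight≡0-++ ((w , X) ∷ K) L (w≥0 ∷ K≥0) wK≡0 =
    trans (mix₂-zero (w ≟ 0ℚ) _ (x+y≡0⇒x≡0 w≥0 (weight-nonNeg K≥0) wK≡0))
          (mix-weight≡0-++ K L K≥0 (x+y≡0⇒y≡0 w≥0 (weight-nonNeg K≥0) wK≡0))

  mix-weight≡0 : ∀ L → NonNegWeights L → weight L ≡ 0ℚ → mix L ≡ 𝟎
  mix-weight≡0 L L≥0 L≡0 = trans (cong mix (sym (++-identityʳ L))) (mix-weight≡0-++ L [] L≥0 L≡0)

  mix-++ : ∀ K L → NonNegWeights K → NonNegWeights L → 0ℚ < weight K → 0ℚ < weight L →
           mix (K ++ L) ≅ (mix K ⊕⟨ ratio (weight K) (weight L) ⟩ mix L)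
  mix-++ [] L _ _ 0<0 _ = ⊥-elim (<-irrefl refl 0<0)
  mix-++ ((w , X) ∷ K) L (w≥0 ∷ K≥0) L≥0 w+wK>0 wL>0 =
    ≅-trans (mix₂-cong (w ≟ 0ℚ) (w ≟ 0ℚ) (weight (K ++ L) ≟ 0ℚ) (weight K + weight L ≟ 0ℚ)
                       refl (weight-++ K L) ≅-refl)
      (mix₂-split (w ≟ 0ℚ) (weight K + weight L ≟ 0ℚ) (weight K ≟ 0ℚ) w≥0 (weight-nonNeg K≥0) wL>0 w+wK>0
        (λ wK≢0 → mix-++ K L K≥0 L≥0 (≥0∧≢0⇒>0 (weight-nonNeg K≥0) wK≢0) wL>0)
        (λ wK≡0 → ≅-reflexive (mix-weight≡0-++ K L K≥0 wK≡0)))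

  mix-scaleʷ : ∀ c L → 0ℚ < c → NonNegWeights L → mix (scaleʷ c L) ≅ mix L
  mix-scaleʷ c [] _ _ = ≅-refl
  mix-scaleʷ c ((w , X) ∷ L) c>0 (w≥0 ∷ L≥0) =
    ≅-trans (mix₂-cong (c * w ≟ 0ℚ) (c * w ≟ 0ℚ) (weight (scaleʷ c L) ≟ 0ℚ) (c * weight L ≟ 0ℚ)
                       refl (weight-scaleʷ c L) ≅-refl)
      (mix₂-scale (c * w ≟ 0ℚ) (c * weight L ≟ 0ℚ) (w ≟ 0ℚ) (weight L ≟ 0ℚ) c>0 w≥0 (weight-nonNeg L≥0)
        (mix-scaleʷ c L c>0 L≥0))

-- Completeness of the probabilistic laws

module _ {n : ℕ} where

  stateProcs : Dist {n} → List (ℚ × Proc n)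
  stateProcs = map (λ { (w , s) → (w , ⌜ s ⌝) })

  stateProcs-scale : ∀ c (Δ : Dist {n}) → stateProcs (scale c Δ) ≡ scaleʷ c (stateProcs Δ)
  stateProcs-scale c [] = refl
  stateProcs-scale c (_ ∷ Δ) = cong (_ ∷_) (stateProcs-scale c Δ)

  weight-stateProcs : ∀ (Δ : Dist {n}) → weight (stateProcs Δ) ≡ weight Δ
  weight-stateProcs [] = refl
  weight-stateProcs ((w , _) ∷ Δ) = cong (w +_) (weight-stateProcs Δ)

  stateProcs-nonNeg : ∀ {Δ : Dist {n}} → NonNegWeights Δ → NonNegWeights (stateProcs Δ)
  stateProcs-nonNeg [] = []
  stateProcs-nonNeg (w≥0 ∷ Δ≥0) = w≥0 ∷ stateProcs-nonNeg Δ≥0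

  mix-⟦⟧ : ∀ (T : Proc n) → mix (stateProcs ⟦ T ⟧) ≅ T
  mix-⟦⟧ ⌜ s ⌝ = ≅-refl
  mix-⟦⟧ (A ⊕⟨ p ⟩ B) =
    ≅-trans (≅-reflexive (cong mix (trans (map-++ _ (scale (val p) ⟦ A ⟧) _)
                                          (cong₂ _++_ (stateProcs-scale (val p) ⟦ A ⟧)
                                                      (stateProcs-scale (1ℚ - val p) ⟦ B ⟧)))))
    (≅-trans (mix-++ LA LB LA≥0 LB≥0 LA>0 LB>0)
    (≅-trans (⊕-cong (mix-scaleʷ (val p) (stateProcs ⟦ A ⟧) (val>0 p) (stateProcs-nonNeg (⟦⟧-nonNeg A)))
                     (mix-scaleʷ (1ℚ - val p) (stateProcs ⟦ B ⟧) (1-val>0 p) (stateProcs-nonNeg (⟦⟧-nonNeg B))))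
    (≅-trans (⊕-cong-prob {q = p} ratio≡p) (⊕-cong (mix-⟦⟧ A) (mix-⟦⟧ B)))))
    where
    LA : List (ℚ × Proc n)
    LA = scaleʷ (val p) (stateProcs ⟦ A ⟧)
    LB : List (ℚ × Proc n)
    LB = scaleʷ (1ℚ - val p) (stateProcs ⟦ B ⟧)
    LA≥0 : NonNegWeights LA
    LA≥0 = scaleʷ-nonNeg (<⇒≤ (val>0 p)) (stateProcs-nonNeg (⟦⟧-nonNeg A))
    LB≥0 : NonNegWeights LB
    LB≥0 = scaleʷ-nonNeg (<⇒≤ (1-val>0 p)) (stateProcs-nonNeg (⟦⟧-nonNeg B))
    weight-LA : weight LA ≡ val p * 1ℚ
    weight-LA = trans (weight-scaleʷ (val p) (stateProcs ⟦ A ⟧))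
                      (cong (val p *_) (trans (weight-stateProcs ⟦ A ⟧) (⟦⟧-weight A)))
    weight-LB : weight LB ≡ (1ℚ - val p) * 1ℚ
    weight-LB = trans (weight-scaleʷ (1ℚ - val p) (stateProcs ⟦ B ⟧))
                      (cong ((1ℚ - val p) *_) (trans (weight-stateProcs ⟦ B ⟧) (⟦⟧-weight B)))
    LA>0 : 0ℚ < weight LA
    LA>0 = subst (0ℚ <_) (trans (sym (*-identityʳ (val p))) (sym weight-LA)) (val>0 p)
    LB>0 : 0ℚ < weight LB
    LB>0 = subst (0ℚ <_) (trans (sym (*-identityʳ (1ℚ - val p))) (sym weight-LB)) (1-val>0 p)
    convex-1 : ∀ p → p * (p * 1ℚ + (1ℚ - p) * 1ℚ) ≡ p * 1ℚ
    convex-1 = solve-∀ ℚ-ring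
    ratio≡p : val (ratio (weight LA) (weight LB)) ≡ val p
    ratio≡p = ratio-unique (val p) LA>0 LB>0
      (trans (cong₂ (λ a b → val p * (a + b)) weight-LA weight-LB) (trans (convex-1 (val p)) (sym weight-LA)))

  remove : SProc n → Dist {n} → Dist {n}
  remove s [] = []
  remove s ((w , t) ∷ Δ) with t ≟S s
  ... | yes _ = remove s Δ
  ... | no _ = (w , t) ∷ remove s Δ

  remove-nonNeg : ∀ s {Δ : Dist {n}} → NonNegWeights Δ → NonNegWeights (remove s Δ)
  remove-nonNeg s {[]} [] = []
  remove-nonNeg s {(w , t) ∷ Δ} (w≥0 ∷ Δ≥0) with t ≟S s
  ... | yes _ = remove-nonNeg s Δ≥0
  ... | no _ = w≥0 ∷ remove-nonNeg s Δ≥0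

  weight-remove : ∀ s (Δ : Dist {n}) → weight Δ ≡ mass s Δ + weight (remove s Δ)
  weight-remove s [] = sym (+-identityʳ 0ℚ)
  weight-remove s ((w , t) ∷ Δ) with t ≟S s
  ... | yes _ = trans (cong (w +_) (weight-remove s Δ)) (sym (+-assoc w _ _))
  ... | no _ = trans (cong (w +_) (weight-remove s Δ)) (swap-head w (mass s Δ) _)
    where
    swap-head : ∀ x y z → x + (y + z) ≡ y + (x + z)
    swap-head = solve-∀ ℚ-ring

  mass-remove-self : ∀ s (Δ : Dist {n}) → mass s (remove s Δ) ≡ 0ℚ
  mass-remove-self s [] = refl
  mass-remove-self s ((w , t) ∷ Δ) with t ≟S s
  ... | yes _ = mass-remove-self s Δ
  ... | no t≢s with t ≟S s
  ...   | yes t≡s = ⊥-elim (t≢s t≡s)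
  ...   | no _ = mass-remove-self s Δ

  mass-remove-other : ∀ s u (Δ : Dist {n}) → u ≢ s → mass u (remove s Δ) ≡ mass u Δ
  mass-remove-other s u [] _ = refl
  mass-remove-other s u ((w , t) ∷ Δ) u≢s with t ≟S s
  ... | yes refl with t ≟S u
  ...   | yes refl = ⊥-elim (u≢s refl)
  ...   | no _ = mass-remove-other s u Δ u≢s
  mass-remove-other s u ((w , t) ∷ Δ) u≢s | no _ with t ≟S u
  ...   | yes _ = cong (w +_) (mass-remove-other s u Δ u≢s)
  ...   | no _ = mass-remove-other s u Δ u≢s

  length-remove : ∀ s (Δ : Dist {n}) → length (remove s Δ) ℕ.≤ length Δ
  length-remove s [] = ℕ.z≤n
  length-remove s ((w , t) ∷ Δ) with t ≟S s
  ... | yes _ = ℕP.m≤n⇒m≤1+n (length-remove s Δ)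
  ... | no _ = s≤s (length-remove s Δ)

  remove-head : ∀ s w (Δ : Dist {n}) → remove s ((w , s) ∷ Δ) ≡ remove s Δ
  remove-head s w Δ with s ≟S s
  ... | yes _ = refl
  ... | no s≢s = ⊥-elim (s≢s refl)

  weight-stateProcs-remove : ∀ s (Δ : Dist {n}) →
                             weight (stateProcs Δ) ≡ mass s Δ + weight (stateProcs (remove s Δ))
  weight-stateProcs-remove s Δ = trans (weight-stateProcs Δ)
    (trans (weight-remove s Δ) (cong (mass s Δ +_) (sym (weight-stateProcs (remove s Δ)))))

  mix-pull : ∀ s (Δ : Dist {n}) → NonNegWeights Δ →
             mix (stateProcs Δ) ≅ mix ((mass s Δ , ⌜ s ⌝) ∷ stateProcs (remove s Δ))
  mix-pull s [] _ = ≅-refl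
  mix-pull s ((w , t) ∷ Δ) (w≥0 ∷ Δ≥0) with t ≟S s
  ... | yes refl =
    ≅-trans (mix-cong-tail w ⌜ t ⌝ (stateProcs Δ) ((mass t Δ , ⌜ t ⌝) ∷ stateProcs (remove t Δ))
                           (weight-stateProcs-remove t Δ) (mix-pull t Δ Δ≥0))
            (mix-merge w ⌜ t ⌝ (mass t Δ) (stateProcs (remove t Δ))
                       w≥0 (mass-nonNeg t Δ≥0) (stateProcs-nonNeg (remove-nonNeg t Δ≥0)))
  ... | no _ =
    ≅-trans (mix-cong-tail w ⌜ t ⌝ (stateProcs Δ) ((mass s Δ , ⌜ s ⌝) ∷ stateProcs (remove s Δ))
                           (weight-stateProcs-remove s Δ) (mix-pull s Δ Δ≥0))
            (mix-swap w ⌜ t ⌝ (mass s Δ) ⌜ s ⌝ (stateProcs (remove s Δ))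
                      w≥0 (mass-nonNeg s Δ≥0) (stateProcs-nonNeg (remove-nonNeg s Δ≥0)))

  mix-≈ : ∀ k (Δ Δ′ : Dist {n}) → length Δ ℕ.≤ k → NonNegWeights Δ → NonNegWeights Δ′ →
          weight Δ ≡ weight Δ′ → Δ ≈ Δ′ → mix (stateProcs Δ) ≅ mix (stateProcs Δ′)
  mix-≈ k [] Δ′ _ _ Δ′≥0 0≡wΔ′ _ =
    ≅-sym (≅-reflexive (mix-weight≡0 (stateProcs Δ′) (stateProcs-nonNeg Δ′≥0)
                                      (trans (weight-stateProcs Δ′) (sym 0≡wΔ′))))
  mix-≈ (suc k) Δ@((w , s) ∷ Δ₀) Δ′ (s≤s |Δ₀|≤k) Δ≥0 Δ′≥0 wΔ≡wΔ′ Δ≈Δ′ =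
    ≅-trans (mix-pull s Δ Δ≥0)
      (≅-trans (mix₂-cong (mass s Δ ≟ 0ℚ) (mass s Δ′ ≟ 0ℚ)
                          (weight (stateProcs (remove s Δ)) ≟ 0ℚ) (weight (stateProcs (remove s Δ′)) ≟ 0ℚ)
                          (Δ≈Δ′ s) weights-rest rest≅)
        (≅-sym (mix-pull s Δ′ Δ′≥0)))
    where
    weights-rest : weight (stateProcs (remove s Δ)) ≡ weight (stateProcs (remove s Δ′))
    weights-rest = +-cancelˡ-≡ (mass s Δ) _ _ (begin
      mass s Δ + weight (stateProcs (remove s Δ))    ≡⟨ weight-stateProcs-remove s Δ ⟨
      weight (stateProcs Δ)                          ≡⟨ weight-stateProcs Δ ⟩
      weight Δ                                       ≡⟨ wΔ≡wΔ′ ⟩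
      weight Δ′                                      ≡⟨ weight-stateProcs Δ′ ⟨
      weight (stateProcs Δ′)                         ≡⟨ weight-stateProcs-remove s Δ′ ⟩
      mass s Δ′ + weight (stateProcs (remove s Δ′))  ≡⟨ cong (_+ _) (Δ≈Δ′ s) ⟨
      mass s Δ + weight (stateProcs (remove s Δ′))   ∎)
      where open ≡-Reasoning
    |rest|≤k : length (remove s Δ) ℕ.≤ k
    |rest|≤k = subst (λ L → length L ℕ.≤ k) (sym (remove-head s w Δ₀)) (ℕP.≤-trans (length-remove s Δ₀) |Δ₀|≤k)
    rest≈rest : remove s Δ ≈ remove s Δ′
    rest≈rest t with t ≟S s
    ... | yes refl = trans (mass-remove-self s Δ) (sym (mass-remove-self s Δ′))
    ... | no t≢s = trans (mass-remove-other s t Δ t≢s) (trans (Δ≈Δ′ t) (sym (mass-remove-other s t Δ′ t≢s)))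
    rest≅ : mix (stateProcs (remove s Δ)) ≅ mix (stateProcs (remove s Δ′))
    rest≅ = mix-≈ k (remove s Δ) (remove s Δ′) |rest|≤k (remove-nonNeg s Δ≥0) (remove-nonNeg s Δ′≥0)
              (trans (sym (weight-stateProcs (remove s Δ))) (trans weights-rest (weight-stateProcs (remove s Δ′))))
              rest≈rest

  ⟦⟧-complete : ∀ {T U : Proc n} → ⟦ T ⟧ ≈ ⟦ U ⟧ → T ≅ U
  ⟦⟧-complete {T} {U} T≈U = ≅-trans (≅-sym (mix-⟦⟧ T))
    (≅-trans (mix-≈ (length ⟦ T ⟧) ⟦ T ⟧ ⟦ U ⟧ ℕP.≤-refl (⟦⟧-nonNeg T) (⟦⟧-nonNeg U)
                    (trans (⟦⟧-weight T) (sym (⟦⟧-weight U))) T≈U)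
      (mix-⟦⟧ U))

module _ {n : ℕ} where

  -- Δ ≈ Θ is a Π-type that does not determine Δ and Θ; the wrapper does.
  record _≋_ (Δ Θ : Dist {n}) : Set where
    constructor mk≋
    field ≋⇒≈ : Δ ≈ Θ
  open _≋_ public

  ≋-sym : ∀ {Δ Θ : Dist {n}} → Δ ≋ Θ → Θ ≋ Δ
  ≋-sym (mk≋ Δ≈Θ) = mk≋ λ t → sym (Δ≈Θ t)

  ≋-trans : ∀ {Δ Θ Ψ : Dist {n}} → Δ ≋ Θ → Θ ≋ Ψ → Δ ≋ Ψ
  ≋-trans (mk≋ Δ≈Θ) (mk≋ Θ≈Ψ) = mk≋ λ t → trans (Δ≈Θ t) (Θ≈Ψ t)

  ≡⇒≋ : ∀ {Δ Θ : Dist {n}} → Δ ≡ Θ → Δ ≋ Θ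
  ≡⇒≋ refl = mk≋ λ _ → refl

  ⟦⟧-≋⇒⊑ : ∀ {T U : Proc n} {Δ} → ⟦ T ⟧ ≋ Δ → ⟦ U ⟧ ≋ Δ → T ⊑May U
  ⟦⟧-≋⇒⊑ T≋Δ U≋Δ = proj₁ (⟦⟧-complete (≋⇒≈ (≋-trans T≋Δ (≋-sym U≋Δ))))

  procOf : Dist {n} → Proc n
  procOf Φ = mix (stateProcs Φ)

  mixMass-stateProcs : ∀ t (Φ : Dist {n}) → mixMass t (stateProcs Φ) ≡ mass t Φ
  mixMass-stateProcs t [] = refl
  mixMass-stateProcs t ((w , s) ∷ Φ) with s ≟S t
  ... | yes _ = trans (cong (_+ _) (*-identityʳ w)) (cong (w +_) (mixMass-stateProcs t Φ))
  ... | no _ = trans (cong (_+ _) (*-zeroʳ w)) (trans (+-identityˡ _) (mixMass-stateProcs t Φ))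

  ⟦procOf⟧ : ∀ {Φ : Dist {n}} → IsDist Φ → ⟦ procOf Φ ⟧ ≋ Φ
  ⟦procOf⟧ {Φ} (Φ≥0 , Φ≡1) = mk≋ λ t →
    trans (mass-mix t (stateProcs-nonNeg Φ≥0) (trans (weight-stateProcs Φ) Φ≡1)) (mixMass-stateProcs t Φ)

-- The expansion law

module _ {n : ℕ} where

  target : ∀ {s : SProc n} {α Δ} → s —[ α ]→ Δ → Proc n
  target (pre {P = P}) = P
  target (intˡ {P = P}) = P
  target (intʳ {Q = Q}) = Q
  target (extˡ d) = target d
  target (extʳ d) = target d
  target (extτˡ {s₂ = s₂} d) = target d □ ⌜ s₂ ⌝
  target (extτʳ {s₁ = s₁} d) = ⌜ s₁ ⌝ □ target d

  scale-□ᴰ : ∀ p (Δ : Dist {n}) t → scale p Δ □ᴰ t ≡ scale p (Δ □ᴰ t)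
  scale-□ᴰ p [] t = refl
  scale-□ᴰ p (_ ∷ Δ) t = cong (_ ∷_) (scale-□ᴰ p Δ t)

  scale-□ᴰ′ : ∀ p (Δ : Dist {n}) t → t □ᴰ′ scale p Δ ≡ scale p (t □ᴰ′ Δ)
  scale-□ᴰ′ p [] t = refl
  scale-□ᴰ′ p (_ ∷ Δ) t = cong (_ ∷_) (scale-□ᴰ′ p Δ t)

  ⟦□state⟧ : ∀ (T : Proc n) t → ⟦ T □ ⌜ t ⌝ ⟧ ≡ ⟦ T ⟧ □ᴰ t
  ⟦□state⟧ ⌜ s ⌝ t = refl
  ⟦□state⟧ (A ⊕⟨ p ⟩ B) t = sym (trans (map-++ _ (scale (val p) ⟦ A ⟧) _)
    (cong₂ _++_ (trans (scale-□ᴰ (val p) ⟦ A ⟧ t) (cong (scale (val p)) (sym (⟦□state⟧ A t))))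
                (trans (scale-□ᴰ (1ℚ - val p) ⟦ B ⟧ t) (cong (scale (1ℚ - val p)) (sym (⟦□state⟧ B t))))))

  ⟦state□⟧ : ∀ (T : Proc n) t → ⟦ ⌜ t ⌝ □ T ⟧ ≡ t □ᴰ′ ⟦ T ⟧
  ⟦state□⟧ ⌜ s ⌝ t = refl
  ⟦state□⟧ (A ⊕⟨ p ⟩ B) t = sym (trans (map-++ _ (scale (val p) ⟦ A ⟧) _)
    (cong₂ _++_ (trans (scale-□ᴰ′ (val p) ⟦ A ⟧ t) (cong (scale (val p)) (sym (⟦state□⟧ A t))))
                (trans (scale-□ᴰ′ (1ℚ - val p) ⟦ B ⟧ t) (cong (scale (1ℚ - val p)) (sym (⟦state□⟧ B t))))))

  ⟦target⟧ : ∀ {s : SProc n} {α Δ} (d : s —[ α ]→ Δ) → ⟦ target d ⟧ ≡ Δ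
  ⟦target⟧ pre = refl
  ⟦target⟧ intˡ = refl
  ⟦target⟧ intʳ = refl
  ⟦target⟧ (extˡ d) = ⟦target⟧ d
  ⟦target⟧ (extʳ d) = ⟦target⟧ d
  ⟦target⟧ (extτˡ {s₂ = s₂} d) = trans (⟦□state⟧ (target d) s₂) (cong (_□ᴰ s₂) (⟦target⟧ d))
  ⟦target⟧ (extτʳ {s₁ = s₁} d) = trans (⟦state□⟧ (target d) s₁) (cong (s₁ □ᴰ′_) (⟦target⟧ d))

  Transition : SProc n → Set
  Transition s = Σ Label λ α → Σ Dist λ Δ → s —[ α ]→ Δ

  liftˡ : ∀ {s₁} s₂ → Transition s₁ → Transition (s₁ □ˢ s₂)
  liftˡ s₂ (τ , Δ , d) = τ , Δ □ᴰ s₂ , extτˡ d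
  liftˡ s₂ (act a , Δ , d) = act a , Δ , extˡ d

  liftʳ : ∀ s₁ {s₂} → Transition s₂ → Transition (s₁ □ˢ s₂)
  liftʳ s₁ (τ , Δ , d) = τ , s₁ □ᴰ′ Δ , extτʳ d
  liftʳ s₁ (act a , Δ , d) = act a , Δ , extʳ d

  transitions : (s : SProc n) → List (Transition s)
  transitions nil = []
  transitions (a · P) = (act a , ⟦ P ⟧ , pre) ∷ []
  transitions (P ⊓ˢ Q) = (τ , ⟦ P ⟧ , intˡ) ∷ (τ , ⟦ Q ⟧ , intʳ) ∷ []
  transitions (s₁ □ˢ s₂) = map (liftˡ s₂) (transitions s₁) ++ map (liftʳ s₁) (transitions s₂)

  continuation : ∀ {s : SProc n} α {Δ} → s —[ α ]→ Δ → Proc n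
  continuation τ d = target d
  continuation (act a) d = a ∙ target d

  branch : ∀ {s} → Transition s → Proc n
  branch (α , _ , d) = continuation α d

  ⨅ : List (Proc n) → Proc n
  ⨅ [] = 𝟎
  ⨅ (P ∷ Ps) = P ⊓ ⨅ Ps

  expansion : SProc n → Proc n
  expansion s = ⨅ (map branch (transitions s))

  ⊓-lub : ∀ {P Q T : Proc n} → P ⊑May T → Q ⊑May T → (P ⊓ Q) ⊑May T
  ⊓-lub P⊑T Q⊑T = trans′ (mono-⊓ P⊑T Q⊑T) (eq→ I1)

  ⊓-ubʳ : ∀ {P Q : Proc n} → Q ⊑May (P ⊓ Q)
  ⊓-ubʳ = trans′ May1 (eq→ I2)

  ⨅-lub : ∀ Ps {T : Proc n} → (∀ {P} → P ∈ Ps → P ⊑May T) → ⨅ Ps ⊑May T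
  ⨅-lub [] _ = May2
  ⨅-lub (P ∷ Ps) Ps⊑T = ⊓-lub (Ps⊑T (here refl)) (⨅-lub Ps (Ps⊑T ∘ there))

  ⨅-ub : ∀ {Ps} {P : Proc n} → P ∈ Ps → P ⊑May ⨅ Ps
  ⨅-ub (here refl) = May1
  ⨅-ub (there P∈Ps) = trans′ (⨅-ub P∈Ps) ⊓-ubʳ

  ∈-map-elim : ∀ {A : Set} {xs : List A} (f : A → Proc n) {Q : Proc n → Set} →
               (∀ {x} → x ∈ xs → Q (f x)) → ∀ {P} → P ∈ map f xs → Q P
  ∈-map-elim f Qf P∈ with ∈-map⁻ f P∈
  ... | _ , x∈ , refl = Qf x∈

  ⊑-□ʳ : ∀ (s₁ s₂ : SProc n) → ⌜ s₁ ⌝ ⊑May ⌜ s₁ □ˢ s₂ ⌝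
  ⊑-□ʳ s₁ s₂ = trans′ (eq← E1) (mono-□ refl′ May2)

  continuation⊑ : ∀ {s : SProc n} {α Δ} (d : s —[ α ]→ Δ) → continuation α d ⊑May ⌜ s ⌝
  continuation⊑ pre = refl′
  continuation⊑ intˡ = May1
  continuation⊑ intʳ = ⊓-ubʳ
  continuation⊑ (extˡ {s₁ = s₁} {s₂} d) = trans′ (continuation⊑ d) (⊑-□ʳ s₁ s₂)
  continuation⊑ (extʳ {s₁ = s₁} {s₂} d) = trans′ (continuation⊑ d) (trans′ (⊑-□ʳ s₂ s₁) (eq→ E2))
  continuation⊑ (extτˡ d) = mono-□ (continuation⊑ d) refl′
  continuation⊑ (extτʳ d) = mono-□ refl′ (continuation⊑ d)

  expansion⊑ : ∀ (s : SProc n) → expansion s ⊑May ⌜ s ⌝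
  expansion⊑ s = ⨅-lub (map branch (transitions s)) (∈-map-elim branch λ { {_ , _ , d} _ → continuation⊑ d })

  branch⊑expansion : ∀ {s : SProc n} {e} → e ∈ transitions s → branch e ⊑May expansion s
  branch⊑expansion e∈ = ⨅-ub (∈-map⁺ branch e∈)

  ⨅-□-⨅-lub : ∀ Ps Qs {T : Proc n} →
              (∀ {P} → P ∈ Ps → (P □ ⨅ Qs) ⊑May T) → (𝟎 □ ⨅ Qs) ⊑May T →
              (∀ {Q} → Q ∈ Qs → (⨅ Ps □ Q) ⊑May T) → (⨅ Ps □ 𝟎) ⊑May T →
              (⨅ Ps □ ⨅ Qs) ⊑May T
  ⨅-□-⨅-lub [] Qs _ 𝟎□Qs _ _ = 𝟎□Qs
  ⨅-□-⨅-lub (P ∷ Ps) [] _ _ _ Ps□𝟎 = Ps□𝟎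
  ⨅-□-⨅-lub (P ∷ Ps) (Q ∷ Qs) P□ 𝟎□ □Q □𝟎 =
    trans′ (eq→ D3) (⊓-lub (P□ (here refl)) (⊓-lub
      (⨅-□-⨅-lub Ps (Q ∷ Qs) (P□ ∘ there) 𝟎□ (λ Q∈ → trans′ (mono-□ ⊓-ubʳ refl′) (□Q Q∈))
                 (trans′ (mono-□ ⊓-ubʳ refl′) □𝟎))
      (⊓-lub (□Q (here refl))
        (⨅-□-⨅-lub (P ∷ Ps) Qs (λ P∈ → trans′ (mono-□ refl′ ⊓-ubʳ) (P□ P∈))
                   (trans′ (mono-□ refl′ ⊓-ubʳ) 𝟎□) (□Q ∘ there) □𝟎))))

  prefix-□-⨅-lub : ∀ a (X : Proc n) Qs {T} → ((a ∙ X) □ 𝟎) ⊑May T →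
                   (∀ {Q} → Q ∈ Qs → ((a ∙ X) □ Q) ⊑May T) → ((a ∙ X) □ ⨅ Qs) ⊑May T
  prefix-□-⨅-lub a X [] aX□𝟎 _ = aX□𝟎
  prefix-□-⨅-lub a X (Q ∷ Qs) aX□𝟎 aX□ =
    trans′ (eq→ D2) (⊓-lub (aX□ (here refl)) (prefix-□-⨅-lub a X Qs aX□𝟎 (aX□ ∘ there)))

  module _ (s₁ s₂ : SProc n) where
    private
      E : Proc n
      E = expansion (s₁ □ˢ s₂)

      liftˡ⊑ : ∀ {e} → e ∈ transitions s₁ → branch (liftˡ s₂ e) ⊑May E
      liftˡ⊑ e∈ = branch⊑expansion (∈-++⁺ˡ (∈-map⁺ (liftˡ s₂) e∈))

      liftʳ⊑ : ∀ {e} → e ∈ transitions s₂ → branch (liftʳ s₁ e) ⊑May E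
      liftʳ⊑ e∈ = branch⊑expansion (∈-++⁺ʳ (map (liftˡ s₂) (transitions s₁)) (∈-map⁺ (liftʳ s₁) e∈))

      branchˡ-□ : ∀ {e} → e ∈ transitions s₁ → (branch e □ expansion s₂) ⊑May E
      branchˡ-□ {τ , _ , d} e∈ = trans′ (mono-□ refl′ (expansion⊑ s₂)) (liftˡ⊑ e∈)
      branchˡ-□ {act a , _ , d} e∈ =
        prefix-□-⨅-lub a (target d) _ (trans′ (eq→ E1) (liftˡ⊑ e∈)) (∈-map-elim branch against)
        where
        against : ∀ {e′} → e′ ∈ transitions s₂ → ((a ∙ target d) □ branch e′) ⊑May E
        against {τ , _ , _} e′∈ = trans′ (mono-□ (continuation⊑ d) refl′) (liftʳ⊑ e′∈)
        against {act b , _ , _} e′∈ = trans′ (eq→ May0) (⊓-lub (liftˡ⊑ e∈) (liftʳ⊑ e′∈))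

      branchʳ-□ : ∀ {e} → e ∈ transitions s₂ → (expansion s₁ □ branch e) ⊑May E
      branchʳ-□ {τ , _ , d} e∈ = trans′ (mono-□ (expansion⊑ s₁) refl′) (liftʳ⊑ e∈)
      branchʳ-□ {act b , _ , d} e∈ =
        trans′ (eq→ E2) (prefix-□-⨅-lub b (target d) _ (trans′ (eq→ E1) (liftʳ⊑ e∈)) (∈-map-elim branch against))
        where
        against : ∀ {e′} → e′ ∈ transitions s₁ → ((b ∙ target d) □ branch e′) ⊑May E
        against {τ , _ , _} e′∈ = trans′ (eq→ E2) (trans′ (mono-□ refl′ (continuation⊑ d)) (liftˡ⊑ e′∈))
        against {act a , _ , _} e′∈ = trans′ (eq→ May0) (⊓-lub (liftʳ⊑ e∈) (liftˡ⊑ e′∈))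

      𝟎-□-expansion : (𝟎 □ expansion s₂) ⊑May E
      𝟎-□-expansion = trans′ (eq→ E2) (trans′ (eq→ E1) (⨅-lub _ (∈-map-elim branch branch⊑)))
        where
        branch⊑ : ∀ {e} → e ∈ transitions s₂ → branch e ⊑May E
        branch⊑ {τ , _ , _} e∈ = trans′ (eq← E1) (trans′ (eq→ E2) (trans′ (mono-□ May2 refl′) (liftʳ⊑ e∈)))
        branch⊑ {act _ , _ , _} e∈ = liftʳ⊑ e∈

      expansion-□-𝟎 : (expansion s₁ □ 𝟎) ⊑May E
      expansion-□-𝟎 = trans′ (eq→ E1) (⨅-lub _ (∈-map-elim branch branch⊑))
        where
        branch⊑ : ∀ {e} → e ∈ transitions s₁ → branch e ⊑May E
        branch⊑ {τ , _ , _} e∈ = trans′ (eq← E1) (trans′ (mono-□ refl′ May2) (liftˡ⊑ e∈))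
        branch⊑ {act _ , _ , _} e∈ = liftˡ⊑ e∈

    expansion-□ : (expansion s₁ □ expansion s₂) ⊑May expansion (s₁ □ˢ s₂)
    expansion-□ = ⨅-□-⨅-lub _ _ (∈-map-elim branch branchˡ-□) 𝟎-□-expansion
                                 (∈-map-elim branch branchʳ-□) expansion-□-𝟎

  ⊑expansion : ∀ (s : SProc n) → ⌜ s ⌝ ⊑May expansion s
  ⊑expansion nil = refl′
  ⊑expansion (a · P) = May1
  ⊑expansion (P ⊓ˢ Q) = mono-⊓ refl′ May1
  ⊑expansion (s₁ □ˢ s₂) = trans′ (mono-□ (⊑expansion s₁) (⊑expansion s₂)) (expansion-□ s₁ s₂)

module _ {n : ℕ} where

  Entry : Set
  Entry = ℚ × SProc n × Dist {n}

  sources : List Entry → Dist {n}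
  sources = map (λ { (p , s , _) → (p , s) })

  targets : List Entry → Dist {n}
  targets = concatMap (λ { (p , _ , Φ) → scale p Φ })

  LiftEntry : ∀ {ℓ} → (SProc n → Dist {n} → Set ℓ) → Entry → Set ℓ
  LiftEntry R (p , s , Φ) = 0ℚ ≤ p × R s Φ

module _ {n : ℕ} {ℓ} {Q : Entry {n} → Set ℓ} where

  weightedBy : ∀ L → All Q L → (∀ e → Q e → Proc n) → List (ℚ × Proc n)
  weightedBy [] [] g = []
  weightedBy (e ∷ L) (q ∷ A) g = (proj₁ e , g e q) ∷ weightedBy L A g

  weight-weightedBy : ∀ L A g → weight (weightedBy L A g) ≡ weight L
  weight-weightedBy [] [] g = refl
  weight-weightedBy (e ∷ L) (q ∷ A) g = cong (proj₁ e +_) (weight-weightedBy L A g)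

  weightedBy-nonNeg : ∀ L A g → (∀ {e} → Q e → 0ℚ ≤ proj₁ e) → NonNegWeights (weightedBy L A g)
  weightedBy-nonNeg [] [] g _ = []
  weightedBy-nonNeg (e ∷ L) (q ∷ A) g Q⇒≥0 = Q⇒≥0 q ∷ weightedBy-nonNeg L A g Q⇒≥0

  source : ∀ e → Q e → Proc n
  source (_ , s , _) _ = ⌜ s ⌝

  mixMass-weightedBy-targets : ∀ t L A g → (∀ e q → ⟦ g e q ⟧ ≋ proj₂ (proj₂ e)) →
                               mixMass t (weightedBy L A g) ≡ mass t (targets L)
  mixMass-weightedBy-targets t [] [] g _ = refl
  mixMass-weightedBy-targets t ((p , s , Φ) ∷ L) (q ∷ A) g ⟦g⟧≋ =
    trans (cong₂ _+_ (trans (cong (p *_) (≋⇒≈ (⟦g⟧≋ (p , s , Φ) q) t)) (sym (mass-scale t p Φ)))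
                     (mixMass-weightedBy-targets t L A g ⟦g⟧≋))
      (sym (mass-++ t (scale p Φ) (targets L)))

  mixMass-weightedBy-sources : ∀ t L A → mixMass t (weightedBy L A source) ≡ mass t (sources L)
  mixMass-weightedBy-sources t [] [] = refl
  mixMass-weightedBy-sources t ((p , s , Φ) ∷ L) (q ∷ A) with s ≟S t
  ... | yes _ = trans (cong (_+ _) (*-identityʳ p)) (cong (p +_) (mixMass-weightedBy-sources t L A))
  ... | no _ = trans (cong (_+ _) (*-zeroʳ p)) (trans (+-identityˡ _) (mixMass-weightedBy-sources t L A))

  mix-weightedBy-mono : ∀ L A g₁ g₂ →
                        (∀ {e} → e ∈ L → (q : Q e) → proj₁ e ≢ 0ℚ → g₁ e q ⊑May g₂ e q) →
                        mix (weightedBy L A g₁) ⊑May mix (weightedBy L A g₂)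
  mix-weightedBy-mono [] [] g₁ g₂ _ = refl′
  mix-weightedBy-mono (e ∷ L) (q ∷ A) g₁ g₂ g₁⊑g₂ =
    mix₂-mono (proj₁ e ≟ 0ℚ) (proj₁ e ≟ 0ℚ) (weight (weightedBy L A g₁) ≟ 0ℚ) (weight (weightedBy L A g₂) ≟ 0ℚ)
      (trans (weight-weightedBy L A g₁) (sym (weight-weightedBy L A g₂)))
      (g₁⊑g₂ (here refl) q) (mix-weightedBy-mono L A g₁ g₂ (g₁⊑g₂ ∘ there))

  mix-weightedBy-prefix : ∀ a L A g → weight L ≢ 0ℚ →
                          (a ∙ mix (weightedBy L A g)) ⊑May mix (weightedBy L A (λ e q → a ∙ g e q))
  mix-weightedBy-prefix a [] [] g L≢0 = ⊥-elim (L≢0 refl)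
  mix-weightedBy-prefix a (e ∷ L) (q ∷ A) g eL≢0 =
    mix₂-prefix a (proj₁ e ≟ 0ℚ) (proj₁ e ≟ 0ℚ) (weight (weightedBy L A g) ≟ 0ℚ) (weight (weightedBy L A ag) ≟ 0ℚ)
      (trans (weight-weightedBy L A g) (sym (weight-weightedBy L A ag)))
      (λ L≢0 → mix-weightedBy-prefix a L A g (L≢0 ∘ trans (weight-weightedBy L A g)))
      (λ e+L≡0 → eL≢0 (trans (cong (proj₁ e +_) (sym (weight-weightedBy L A g))) e+L≡0))
    where
    ag : ∀ e → Q e → Proc n
    ag = λ e q → a ∙ g e q

module _ {n : ℕ} {ℓ} {R : SProc n → Dist {n} → Set ℓ} {L : List (Entry {n})}
         (A : All (LiftEntry R) L) (L≡1 : weight L ≡ 1ℚ) where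

  mixBy : (∀ e → LiftEntry R e → Proc n) → Proc n
  mixBy g = mix (weightedBy L A g)

  ⟦mixBy⟧ : ∀ g → (∀ e q → ⟦ g e q ⟧ ≋ proj₂ (proj₂ e)) → ⟦ mixBy g ⟧ ≋ targets L
  ⟦mixBy⟧ g ⟦g⟧≋ = mk≋ λ t →
    trans (mass-mix t (weightedBy-nonNeg L A g proj₁) (trans (weight-weightedBy L A g) L≡1))
          (mixMass-weightedBy-targets t L A g ⟦g⟧≋)

  ⟦mixBy-source⟧ : ⟦ mixBy source ⟧ ≋ sources L
  ⟦mixBy-source⟧ = mk≋ λ t →
    trans (mass-mix t (weightedBy-nonNeg L A source proj₁) (trans (weight-weightedBy L A source) L≡1))
          (mixMass-weightedBy-sources t L A)

  mixBy-⊑ : ∀ g U → (∀ {e} → e ∈ L → (q : LiftEntry R e) → proj₁ e ≢ 0ℚ → g e q ⊑May ⌜ proj₁ (proj₂ e) ⌝) →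
            ⟦ U ⟧ ≋ sources L → mixBy g ⊑May U
  mixBy-⊑ g U g⊑source U≋ =
    trans′ (mix-weightedBy-mono L A g source g⊑source) (⟦⟧-≋⇒⊑ ⟦mixBy-source⟧ U≋)

  ⊑-mixBy : ∀ g X → (∀ {e} → e ∈ L → (q : LiftEntry R e) → proj₁ e ≢ 0ℚ → ⌜ proj₁ (proj₂ e) ⌝ ⊑May g e q) →
            ⟦ X ⟧ ≋ sources L → X ⊑May mixBy g
  ⊑-mixBy g X source⊑g X≋ =
    trans′ (⟦⟧-≋⇒⊑ X≋ ⟦mixBy-source⟧) (mix-weightedBy-mono L A source g source⊑g)

  prefix-mixBy : ∀ a g → (a ∙ mixBy g) ⊑May mixBy (λ e q → a ∙ g e q)
  prefix-mixBy a g = mix-weightedBy-prefix a L A g (λ L≡0 → 1≢0 (trans (sym L≡1) L≡0))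

module _ {n : ℕ} where

  τ̂-target : ∀ (e : Entry {n}) → LiftEntry _—τ̂→_ e → Proc n
  τ̂-target _ (_ , inj₁ d) = target d
  τ̂-target (_ , s , _) (_ , inj₂ _) = ⌜ s ⌝

  ⟹τ̂-sound : ∀ {Δ Θ : Dist {n}} → Δ ⟹τ̂ Θ → ∀ U → ⟦ U ⟧ ≋ Δ → Σ (Proc n) λ V → ⟦ V ⟧ ≋ Θ × V ⊑May U
  ⟹τ̂-sound ε U U≋Δ = U , U≋Δ , refl′
  ⟹τ̂-sound ((L , A , L≡1 , Δ≈ , Δ₁≈) ◅ steps) U U≋Δ
    with ⟹τ̂-sound steps (mixBy A L≡1 τ̂-target) (≋-trans (⟦mixBy⟧ A L≡1 τ̂-target ⟦τ̂-target⟧) (≋-sym (mk≋ Δ₁≈)))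
    where
    ⟦τ̂-target⟧ : ∀ e q → ⟦ τ̂-target e q ⟧ ≋ proj₂ (proj₂ e)
    ⟦τ̂-target⟧ _ (_ , inj₁ d) = ≡⇒≋ (⟦target⟧ d)
    ⟦τ̂-target⟧ _ (_ , inj₂ Φ≈s) = mk≋ λ t → sym (Φ≈s t)
  ... | V , V≋Θ , V⊑ = V , V≋Θ , trans′ V⊑ (mixBy-⊑ A L≡1 τ̂-target U τ̂-target⊑ (≋-trans U≋Δ (mk≋ Δ≈)))
    where
    τ̂-target⊑ : ∀ {e} → e ∈ L → (q : LiftEntry _—τ̂→_ e) → proj₁ e ≢ 0ℚ →
                τ̂-target e q ⊑May ⌜ proj₁ (proj₂ e) ⌝
    τ̂-target⊑ _ (_ , inj₁ d) _ = continuation⊑ d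
    τ̂-target⊑ _ (_ , inj₂ _) _ = refl′

  act-target : ∀ {a} e → LiftEntry (λ s Φ → s —[ act a ]→ Φ) e → Proc n
  act-target _ (_ , d) = target d

  ⟹act-sound : ∀ a {Θ Θ′ : Dist {n}} → Θ ⟹[ act a ] Θ′ →
               ∀ U V → ⟦ U ⟧ ≋ Θ → ⟦ V ⟧ ≋ Θ′ → (a ∙ V) ⊑May U
  ⟹act-sound a (Δ₁ , Δ₂ , before , (L , A , L≡1 , Δ₁≈ , Δ₂≈) , after) U V U≋Θ V≋Θ′
    with ⟹τ̂-sound before U U≋Θ
       | ⟹τ̂-sound after (mixBy A L≡1 act-target)
           (≋-trans (⟦mixBy⟧ A L≡1 act-target λ { _ (_ , d) → ≡⇒≋ (⟦target⟧ d) }) (≋-sym (mk≋ Δ₂≈)))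
  ... | V₁ , V₁≋Δ₁ , V₁⊑U | V₂ , V₂≋Θ′ , V₂⊑M₂ = begin
      a ∙ V                                       ∼⟨ mono-∙ (trans′ (⟦⟧-≋⇒⊑ V≋Θ′ V₂≋Θ′) V₂⊑M₂) ⟩
      a ∙ mixBy A L≡1 act-target                  ∼⟨ prefix-mixBy A L≡1 a act-target ⟩
      mixBy A L≡1 (λ e q → a ∙ act-target e q)    ∼⟨ mixBy-⊑ A L≡1 _ V₁ (λ { _ (_ , d) _ → continuation⊑ d })
                                                                         (≋-trans V₁≋Δ₁ (mk≋ Δ₁≈)) ⟩
      V₁                                          ∼⟨ V₁⊑U ⟩
      U                                           ∎
    where open ⊑-Reasoning

module _ {n : ℕ} where

  mutual
    size : SProc n → ℕ
    size nil = 0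
    size (a · P) = suc (sizeᴾ P)
    size (P ⊓ˢ Q) = suc (sizeᴾ P ℕ.+ sizeᴾ Q)
    size (s₁ □ˢ s₂) = suc (size s₁ ℕ.+ size s₂)

    sizeᴾ : Proc n → ℕ
    sizeᴾ ⌜ s ⌝ = size s
    sizeᴾ (P ⊕⟨ p ⟩ Q) = sizeᴾ P ℕ.+ sizeᴾ Q

  _occursIn_ : SProc n → Dist {n} → Set
  t occursIn Δ = Any (λ e → proj₂ e ≡ t) Δ

  mass≢0⇒occursIn : ∀ t (Δ : Dist {n}) → mass t Δ ≢ 0ℚ → t occursIn Δ
  mass≢0⇒occursIn t [] t∉ = ⊥-elim (t∉ refl)
  mass≢0⇒occursIn t ((w , u) ∷ Δ) t∉ with u ≟S t
  ... | yes u≡t = here u≡t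
  ... | no _ = there (mass≢0⇒occursIn t Δ t∉)

  occursIn-⟦⟧ : ∀ t (P : Proc n) → t occursIn ⟦ P ⟧ → size t ℕ.≤ sizeᴾ P
  occursIn-⟦⟧ t ⌜ s ⌝ (here refl) = ℕP.≤-refl
  occursIn-⟦⟧ t (P ⊕⟨ p ⟩ Q) t∈ with Any.++⁻ (scale (val p) ⟦ P ⟧) t∈
  ... | inj₁ t∈P = ℕP.≤-trans (occursIn-⟦⟧ t P (Any.map⁻ t∈P)) (ℕP.m≤m+n (sizeᴾ P) (sizeᴾ Q))
  ... | inj₂ t∈Q = ℕP.≤-trans (occursIn-⟦⟧ t Q (Any.map⁻ t∈Q)) (ℕP.m≤n+m (sizeᴾ Q) (sizeᴾ P))

  occursIn-□ᴰ : ∀ {t} (Δ : Dist {n}) s₂ → t occursIn (Δ □ᴰ s₂) →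
                Σ (SProc n) λ u → u occursIn Δ × (u □ˢ s₂) ≡ t
  occursIn-□ᴰ ((w , u) ∷ Δ) s₂ (here eq) = u , here refl , eq
  occursIn-□ᴰ (_ ∷ Δ) s₂ (there t∈) with occursIn-□ᴰ Δ s₂ t∈
  ... | u , u∈ , eq = u , there u∈ , eq

  occursIn-□ᴰ′ : ∀ {t} (Δ : Dist {n}) s₁ → t occursIn (s₁ □ᴰ′ Δ) →
                 Σ (SProc n) λ u → u occursIn Δ × (s₁ □ˢ u) ≡ t
  occursIn-□ᴰ′ ((w , u) ∷ Δ) s₁ (here eq) = u , here refl , eq
  occursIn-□ᴰ′ (_ ∷ Δ) s₁ (there t∈) with occursIn-□ᴰ′ Δ s₁ t∈
  ... | u , u∈ , eq = u , there u∈ , eq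

  transition-size : ∀ {s : SProc n} {α Δ t} → s —[ α ]→ Δ → t occursIn Δ → size t ℕ.< size s
  transition-size {t = t} (pre {P = P}) t∈ = s≤s (occursIn-⟦⟧ t P t∈)
  transition-size {t = t} (intˡ {P = P} {Q}) t∈ = s≤s (ℕP.≤-trans (occursIn-⟦⟧ t P t∈) (ℕP.m≤m+n (sizeᴾ P) (sizeᴾ Q)))
  transition-size {t = t} (intʳ {P = P} {Q}) t∈ = s≤s (ℕP.≤-trans (occursIn-⟦⟧ t Q t∈) (ℕP.m≤n+m (sizeᴾ Q) (sizeᴾ P)))
  transition-size (extˡ {s₁ = s₁} {s₂} d) t∈ =
    ℕP.<-≤-trans (transition-size d t∈) (ℕP.m≤n⇒m≤1+n (ℕP.m≤m+n (size s₁) (size s₂)))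
  transition-size (extʳ {s₁ = s₁} {s₂} d) t∈ =
    ℕP.<-≤-trans (transition-size d t∈) (ℕP.m≤n⇒m≤1+n (ℕP.m≤n+m (size s₂) (size s₁)))
  transition-size (extτˡ {s₂ = s₂} {Δ} d) t∈ with occursIn-□ᴰ Δ s₂ t∈
  ... | u , u∈ , refl = s≤s (ℕP.+-monoˡ-< (size s₂) (transition-size d u∈))
  transition-size (extτʳ {s₁ = s₁} {Δ = Δ} d) t∈ with occursIn-□ᴰ′ Δ s₁ t∈
  ... | u , u∈ , refl = s≤s (ℕP.+-monoʳ-< (size s₁) (transition-size d u∈))

  entry≤mass : ∀ {p t} (Δ : Dist {n}) → (p , t) ∈ Δ → NonNegWeights Δ → p ≤ mass t Δ
  entry≤mass {p} {t} ((.p , .t) ∷ Δ) (here refl) (_ ∷ Δ≥0) with t ≟S t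
  ... | yes _ = subst (_≤ p + mass t Δ) (+-identityʳ p) (+-monoʳ-≤ p (mass-nonNeg t Δ≥0))
  ... | no t≢t = ⊥-elim (t≢t refl)
  entry≤mass {t = t} ((w , u) ∷ Δ) (there e∈) (w≥0 ∷ Δ≥0) with u ≟S t
  ... | yes _ = ≤-trans (entry≤mass Δ e∈ Δ≥0) (subst (_≤ w + mass t Δ) (+-identityˡ (mass t Δ)) (+-monoˡ-≤ (mass t Δ) w≥0))
  ... | no _ = entry≤mass Δ e∈ Δ≥0

  sources-nonNeg : ∀ {ℓ} {R : SProc n → Dist {n} → Set ℓ} {L} → All (LiftEntry R) L → NonNegWeights (sources L)
  sources-nonNeg [] = []
  sources-nonNeg ((p≥0 , _) ∷ A) = p≥0 ∷ sources-nonNeg A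

  lift-entry-occurs : ∀ {ℓ} {R : SProc n → Dist {n} → Set ℓ} {L} {Δ : Dist {n}} → All (LiftEntry R) L → Δ ≈ sources L →
                      ∀ {p t Φ} → (p , t , Φ) ∈ L → p ≢ 0ℚ → t occursIn Δ
  lift-entry-occurs {L = L} {Δ} A Δ≈ {p} {t} e∈ p≢0 = mass≢0⇒occursIn t Δ λ t∉Δ →
    <-irrefl refl (<-≤-trans (≥0∧≢0⇒>0 (proj₁ (lookup A e∈)) p≢0)
                             (subst (p ≤_) (trans (sym (Δ≈ t)) t∉Δ) (entry≤mass (sources L) (∈-map⁺ _ e∈) (sources-nonNeg A))))

module _ {n : ℕ} where

  procOf-target : ∀ {ℓ} {R : SProc n → Dist {n} → Set ℓ} e → LiftEntry R e → Proc n
  procOf-target (_ , _ , Φ) _ = procOf Φ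

  ◁S⇒⊑May : ∀ {s : SProc n} {Θ} → s ◁S Θ → ∀ U → ⟦ U ⟧ ≋ Θ → ⌜ s ⌝ ⊑May U
  ◁S⇒⊑May {s} = go s (<-wellFounded (size s))
    where
    go : ∀ s → Acc ℕ._<_ (size s) → ∀ {Θ} → s ◁S Θ → ∀ U → ⟦ U ⟧ ≋ Θ → ⌜ s ⌝ ⊑May U
    go s (acc smaller) {Θ} (R , sim@(isDist , simulates) , sRΘ) U U≋Θ =
      trans′ (⊑expansion s) (⨅-lub _ (∈-map-elim branch λ {e} _ → branch⊑U e))
      where
      matched : ∀ {α Δ} (d : s —[ α ]→ Δ) →
                Σ (Dist {n}) λ Θ′ → Θ ⟹[ α ] Θ′ × Σ (Proc n) λ V → ⟦ V ⟧ ≋ Θ′ × target d ⊑May V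
      matched d with simulates sRΘ d
      ... | Θ′ , Θ⟹Θ′ , (L , A , L≡1 , Δ≈ , Θ′≈) =
        Θ′ , Θ⟹Θ′ , mixBy A L≡1 procOf-target ,
        ≋-trans (⟦mixBy⟧ A L≡1 procOf-target λ { _ (_ , r) → ⟦procOf⟧ (isDist r) }) (≋-sym (mk≋ Θ′≈)) ,
        ⊑-mixBy A L≡1 procOf-target (target d) below (≋-trans (≡⇒≋ (⟦target⟧ d)) (mk≋ Δ≈))
        where
        below : ∀ {e} → e ∈ L → (q : LiftEntry R e) → proj₁ e ≢ 0ℚ →
                ⌜ proj₁ (proj₂ e) ⌝ ⊑May procOf (proj₂ (proj₂ e))
        below {_ , t , Φ} e∈ (_ , tRΦ) p≢0 =
          go t (smaller (transition-size d (lift-entry-occurs A Δ≈ e∈ p≢0))) (R , sim , tRΦ) (procOf Φ) (⟦procOf⟧ (isDist tRΦ))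

      branch⊑U : (e : Transition s) → branch e ⊑May U
      branch⊑U (τ , _ , d) with matched d
      ... | Θ′ , Θ⟹Θ′ , V , V≋Θ′ , d⊑V with ⟹τ̂-sound Θ⟹Θ′ U U≋Θ
      ...   | V′ , V′≋Θ′ , V′⊑U = trans′ d⊑V (trans′ (⟦⟧-≋⇒⊑ V≋Θ′ V′≋Θ′) V′⊑U)
      branch⊑U (act a , _ , d) with matched d
      ... | Θ′ , Θ⟹Θ′ , V , V≋Θ′ , d⊑V = trans′ (mono-∙ d⊑V) (⟹act-sound a Θ⟹Θ′ U V U≋Θ V≋Θ′)

proposition11p2 : {n : ℕ} {P Q : Proc n} → P ⊑S Q → P ⊑May Q
proposition11p2 {P = P} {Q} (Θ , Q⟹Θ , (L , A , L≡1 , P≈ , Θ≈)) with ⟹τ̂-sound Q⟹Θ Q (≡⇒≋ refl)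
... | V′ , V′≋Θ , V′⊑Q = begin
    P                              ∼⟨ ⊑-mixBy A L≡1 procOf-target P below (mk≋ P≈) ⟩
    mixBy A L≡1 procOf-target      ∼⟨ ⟦⟧-≋⇒⊑ ⟦V⟧ V′≋Θ ⟩
    V′                             ∼⟨ V′⊑Q ⟩
    Q                              ∎
  where
  open ⊑-Reasoning
  isDist : ∀ {s Φ} → s ◁S Φ → IsDist Φ
  isDist (_ , (isDist , _) , sRΦ) = isDist sRΦ
  ⟦V⟧ : ⟦ mixBy A L≡1 procOf-target ⟧ ≋ Θ
  ⟦V⟧ = ≋-trans (⟦mixBy⟧ A L≡1 procOf-target λ { _ (_ , s◁Φ) → ⟦procOf⟧ (isDist s◁Φ) }) (≋-sym (mk≋ Θ≈))
  below : ∀ {e} → e ∈ L → (q : LiftEntry _◁S_ e) → proj₁ e ≢ 0ℚ →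
          ⌜ proj₁ (proj₂ e) ⌝ ⊑May procOf (proj₂ (proj₂ e))
  below {_ , _ , Φ} _ (_ , s◁Φ) _ = ◁S⇒⊑May s◁Φ (procOf Φ) (⟦procOf⟧ (isDist s◁Φ))
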